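{- Let $e$ and $p$ be primes such that $e\equiv 1\pmod 6$ and $p$ is semiprimitive modulo $e$. Let $A$ be a positive integer with $A\equiv\pm3\pmod 8$ such that (1) $A^2\equiv -3\pmod e$, and (2) one of the following holds: (2.1) $p=2$ and $v_2(A^2-9)$ is odd; (2.2) $p=3$, $A=3A'$ for an integer $A'$, and $v_3(A'-1)$ or $v_3(A'+1)$ is odd; (2.3) $p\ge 5$ and $v_p(A+3)$ or $v_p(A-3)$ is odd. Then there is no binary sequence $\mathbf a$ of period $n=\tfrac14(A^2+3)$ with $C_{\mathbf a}(t)=3$ for all $1\le t\le n-1$.
   Context: An integer $a$ is semiprimitive modulo $b$ if there is an integer $c$ with $a^c\equiv -1\pmod b$. For a prime $p$ and nonzero integer $m$, $v_p(m)$ is the exponent of the highest power of $p$ dividing $m$ ($v_p(0)=\infty$). A binary sequence of period $n$ is $\mathbf a=(a_0,a_1,\ldots)$ with $a_j\in\{ -1,1\}$, $a_{j+n}=a_j$; $C_{\mathbf a}(t)=\sum_{i=0}^{n-1}a_ia_{i+t}$. -}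

module Defs where

open import Data.Nat as ℕ using (ℕ; zero; suc; _%_; _/_)
open import Data.Nat.Primality using (Prime)
open import Data.Integer as ℤ using (ℤ; +_; -_)
open import Data.Integer.Divisibility using () renaming (_∣_ to _∣ℤ_)
open import Data.Product using (Σ; ∃; _×_)
open import Data.Sum using (_⊎_)
open import Relation.Nullary using (¬_)
open import Relation.Binary.PropositionalEquality using (_≡_)

CongMod : ℤ → ℤ → ℕ → Set
CongMod x y b = (+ b) ∣ℤ (x ℤ.- y)

Semiprimitive : ℤ → ℕ → Set
Semiprimitive a b = ∃ λ (c : ℕ) → CongMod (a ℤ.^ c) (- (+ 1)) b

-- "v_p(m) is odd": v_p(m) = k for some odd k, i.e. p^k ∣ m and p^(k+1) ∤ m.
-- (For m = 0, v_p(m) = ∞ is not odd; this is automatically excluded.)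
OddVal : ℕ → ℤ → Set
OddVal p m = ∃ λ (k : ℕ) → k % 2 ≡ 1 × ((+ (p ℕ.^ k)) ∣ℤ m) × ¬ ((+ (p ℕ.^ suc k)) ∣ℤ m)

sumTo : ℕ → (ℕ → ℤ) → ℤ
sumTo zero    f = + 0
sumTo (suc n) f = sumTo n f ℤ.+ f n

record BinarySeq (n : ℕ) : Set where
  field
    seq      : ℕ → ℤ
    pm1      : ∀ j → seq j ≡ + 1 ⊎ seq j ≡ - (+ 1)
    periodic : ∀ j → seq (j ℕ.+ n) ≡ seq j

autocorr : {n : ℕ} → BinarySeq n → ℕ → ℤ
autocorr {n} a t = sumTo n (λ i → BinarySeq.seq a i ℤ.* BinarySeq.seq a (i ℕ.+ t))

-- Since e ∣ A² + 3 = 4n, e divides n. Folding the sequence modulo e gives Xⱼ = Σ_{i ≡ j} aᵢ, and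
-- Y = eX - ΣX is an integer sequence of period e whose periodic correlation is M·(e - 1) at 0 and
-- -M elsewhere, where M = e(n - 3) = e(A² - 9)/4. In ℤ[x]/(xᵉ - 1) modulo p these correlations are
-- the coefficients of Y(x)·Y(x⁻¹). As p is semiprimitive modulo e, some power q of p is ≡ -1, so
-- Y(x)^q ≡ Y(x^q) = Y(x⁻¹) (mod p); hence p ∣ M forces p ∣ Y. Then Y = pY′ with M = p²M′ of the
-- same shape, and descending contradicts v_p(M) being odd, which is what the conditions on A say.
module Submission where

open import Defs
open import Data.Nat as ℕ using (ℕ; suc; _%_; _/_; _≤_; _<_)
open import Data.Nat.Primality using (Prime)
open import Data.Integer as ℤ using (ℤ; +_; -_)
open import Data.Integer.Divisibility using () renaming (_∣_ to _∣ℤ_)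
open import Data.Product using (Σ; ∃; _×_)
open import Data.Sum using (_⊎_)
open import Relation.Nullary using (¬_)
open import Relation.Binary.PropositionalEquality using (_≡_)

open import Data.Nat using (zero; z≤n; s≤s; _∸_)
import Data.Nat.Properties as ℕP
import Data.Nat.DivMod as ℕD
open import Data.Nat.Divisibility as ℕDiv using (_∣_)
open import Data.Nat.Primality using (euclidsLemma; prime⇒nonTrivial; prime⇒irreducible)
open import Data.Nat.Combinatorics using (_C_; nC1≡n; nCn≡1; nCk+nC[k+1]≡[n+1]C[k+1])
open import Data.Nat.Combinatorics.Specification using (k>n⇒nCk≡0)
import Data.Nat.Tactic.RingSolver as ℕSolver
import Data.Integer.Properties as ℤP
open import Data.Integer.Divisibility.Signed as ℤD using (divides) renaming (_∣_ to _∣ₛ_)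
open import Data.Integer.Tactic.RingSolver using (solve-∀)
open import Data.Fin as Fin using (toℕ; fromℕ; inject₁)
import Data.Fin.Properties as FinP
open import Data.Bool using (true; false; if_then_else_)
open import Data.Empty using (⊥; ⊥-elim)
open import Data.Product using (_,_)
open import Data.Sum as Sum using (inj₁; inj₂)
open import Data.Unit using (tt)
open import Level using (0ℓ)
open import Relation.Nullary using (yes; no)
open import Relation.Nullary.Decidable using (from-no)
open import Relation.Binary.PropositionalEquality
  using (refl; sym; trans; cong; cong₂; subst; subst₂; module ≡-Reasoning)
open import Relation.Binary.Structures using (IsEquivalence)
import Relation.Binary.Reasoning.Setoid as SetoidReasoning
open import Algebra.Bundles using (AbelianGroup; CommutativeSemiring)
open import Algebra.Structures using (IsCommutativeSemiring)
open import Algebra.Structures.Biased using (IsCommutativeSemiringˡ)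
open import Algebra.Properties.Group (AbelianGroup.group ℤP.+-0-abelianGroup)
  using () renaming (∙-cancelʳ to +-cancelʳ)

module Sums where

  open import Data.Integer using (_+_; _*_; 0ℤ; 1ℤ)

  sumTo-cong : ∀ n {f g : ℕ → ℤ} → (∀ i → i < n → f i ≡ g i) → sumTo n f ≡ sumTo n g
  sumTo-cong zero    h = refl
  sumTo-cong (suc n) h = cong₂ _+_ (sumTo-cong n (λ i i<n → h i (ℕP.m<n⇒m<1+n i<n))) (h n ℕP.≤-refl)

  sumTo-ext : ∀ n {f g : ℕ → ℤ} → (∀ i → f i ≡ g i) → sumTo n f ≡ sumTo n g
  sumTo-ext n h = sumTo-cong n (λ i _ → h i)

  sumTo-zero : ∀ n → sumTo n (λ _ → 0ℤ) ≡ 0ℤ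
  sumTo-zero zero    = refl
  sumTo-zero (suc n) = trans (ℤP.+-identityʳ _) (sumTo-zero n)

  sumTo-const : ∀ n c → sumTo n (λ _ → c) ≡ + n * c
  sumTo-const zero    c = sym (ℤP.*-zeroˡ c)
  sumTo-const (suc n) c = begin
    sumTo n (λ _ → c) + c  ≡⟨ cong₂ _+_ (sumTo-const n c) (sym (ℤP.*-identityˡ c)) ⟩
    + n * c + 1ℤ * c       ≡⟨ ℤP.*-distribʳ-+ c (+ n) 1ℤ ⟨
    + (n ℕ.+ 1) * c        ≡⟨ cong (λ m → + m * c) (ℕP.+-comm n 1) ⟩
    + suc n * c            ∎
    where open ≡-Reasoning

  sumTo-+ : ∀ n f g → sumTo n (λ i → f i + g i) ≡ sumTo n f + sumTo n g
  sumTo-+ zero    f g = refl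
  sumTo-+ (suc n) f g = trans (cong (_+ (f n + g n)) (sumTo-+ n f g))
                              (middle-swap (sumTo n f) (sumTo n g) (f n) (g n))
    where
    middle-swap : ∀ a b c d → (a + b) + (c + d) ≡ (a + c) + (b + d)
    middle-swap = solve-∀

  sumTo-*ˡ : ∀ n c f → sumTo n (λ i → c * f i) ≡ c * sumTo n f
  sumTo-*ˡ zero    c f = sym (ℤP.*-zeroʳ c)
  sumTo-*ˡ (suc n) c f =
    trans (cong (_+ c * f n) (sumTo-*ˡ n c f)) (sym (ℤP.*-distribˡ-+ c (sumTo n f) (f n)))

  sumTo-*ʳ : ∀ n c f → sumTo n (λ i → f i * c) ≡ sumTo n f * c
  sumTo-*ʳ n c f =
    trans (sumTo-ext n (λ i → ℤP.*-comm (f i) c)) (trans (sumTo-*ˡ n c f) (ℤP.*-comm c _))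

  sumTo-suc : ∀ n f → sumTo (suc n) f ≡ f 0 + sumTo n (λ i → f (suc i))
  sumTo-suc zero    f = ℤP.+-comm 0ℤ (f 0)
  sumTo-suc (suc n) f = trans (cong (_+ f (suc n)) (sumTo-suc n f)) (ℤP.+-assoc (f 0) _ _)

  sumTo-split : ∀ m k f → sumTo (m ℕ.+ k) f ≡ sumTo m f + sumTo k (λ i → f (m ℕ.+ i))
  sumTo-split m zero    f =
    trans (cong (λ z → sumTo z f) (ℕP.+-identityʳ m)) (sym (ℤP.+-identityʳ _))
  sumTo-split m (suc k) f = trans (cong (λ z → sumTo z f) (ℕP.+-suc m k))
    (trans (cong (_+ f (m ℕ.+ k)) (sumTo-split m k f)) (ℤP.+-assoc (sumTo m f) _ _))

  sumTo-swap : ∀ m k (F : ℕ → ℕ → ℤ) →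
    sumTo m (λ i → sumTo k (F i)) ≡ sumTo k (λ j → sumTo m (λ i → F i j))
  sumTo-swap zero    k F = sym (sumTo-zero k)
  sumTo-swap (suc m) k F = trans (cong (_+ sumTo k (F m)) (sumTo-swap m k F))
    (sym (sumTo-+ k (λ j → sumTo m (λ i → F i j)) (F m)))

  sumTo-reverse : ∀ n f → sumTo n f ≡ sumTo n (λ i → f (n ∸ suc i))
  sumTo-reverse zero    f = refl
  sumTo-reverse (suc n) f = trans (cong (_+ f n) (sumTo-reverse n f))
    (trans (ℤP.+-comm _ (f n)) (sym (sumTo-suc n (λ i → f (suc n ∸ suc i)))))

  sumTo-single : ∀ n f t → t < n → (∀ i → i < n → ¬ i ≡ t → f i ≡ 0ℤ) → sumTo n f ≡ f t
  sumTo-single zero    f t () h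
  sumTo-single (suc n) f t t<1+n h with ℕP.m<1+n⇒m<n∨m≡n t<1+n
  ... | inj₁ t<n = trans
        (cong₂ _+_ (sumTo-single n f t t<n (λ i i<n → h i (ℕP.m<n⇒m<1+n i<n)))
                   (h n ℕP.≤-refl (λ n≡t → ℕP.<⇒≢ t<n (sym n≡t))))
        (ℤP.+-identityʳ _)
  ... | inj₂ refl = trans
        (cong (_+ f t) (trans (sumTo-cong t (λ i i<t → h i (ℕP.m<n⇒m<1+n i<t) (ℕP.<⇒≢ i<t)))
                              (sumTo-zero t)))
        (ℤP.+-identityˡ _)

  sumTo-blocks : ∀ k m F → sumTo (k ℕ.* m) F ≡ sumTo k (λ u → sumTo m (λ j → F (j ℕ.+ u ℕ.* m)))
  sumTo-blocks zero    m F = refl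
  sumTo-blocks (suc k) m F = begin
    sumTo (m ℕ.+ k ℕ.* m) F
      ≡⟨ cong (λ z → sumTo z F) (ℕP.+-comm m (k ℕ.* m)) ⟩
    sumTo (k ℕ.* m ℕ.+ m) F
      ≡⟨ sumTo-split (k ℕ.* m) m F ⟩
    sumTo (k ℕ.* m) F + sumTo m (λ j → F (k ℕ.* m ℕ.+ j))
      ≡⟨ cong₂ _+_ (sumTo-blocks k m F) (sumTo-ext m (λ j → cong F (ℕP.+-comm (k ℕ.* m) j))) ⟩
    sumTo k (λ u → sumTo m (λ j → F (j ℕ.+ u ℕ.* m))) + sumTo m (λ j → F (j ℕ.+ k ℕ.* m)) ∎
    where open ≡-Reasoning

open Sums

module PeriodicFunctions where

  open import Data.Integer using (_+_; _*_; _-_; 0ℤ)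

  Periodic : ℕ → (ℕ → ℤ) → Set
  Periodic m h = ∀ i → h (i ℕ.+ m) ≡ h i

  periodic-+* : ∀ {m h} → Periodic m h → ∀ x k → h (x ℕ.+ k ℕ.* m) ≡ h x
  periodic-+* {m} {h} P x zero    = cong h (ℕP.+-identityʳ x)
  periodic-+* {m} {h} P x (suc k) =
    trans (cong h (shuffle x k m)) (trans (P (x ℕ.+ k ℕ.* m)) (periodic-+* P x k))
    where
    shuffle : ∀ x k m → x ℕ.+ (m ℕ.+ k ℕ.* m) ≡ (x ℕ.+ k ℕ.* m) ℕ.+ m
    shuffle = ℕSolver.solve-∀

  periodic-≡ : ∀ {m h} → Periodic m h → ∀ x y a b → x ℕ.+ a ℕ.* m ≡ y ℕ.+ b ℕ.* m → h x ≡ h y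
  periodic-≡ {m} {h} P x y a b eq =
    trans (sym (periodic-+* P x a)) (trans (cong h eq) (periodic-+* P y b))

  periodic-% : ∀ {m h} .{{_ : ℕ.NonZero m}} → Periodic m h → ∀ x → h (x % m) ≡ h x
  periodic-% {m} {h} P x =
    sym (trans (cong h (ℕD.m≡m%n+[m/n]*n x m)) (periodic-+* P (x % m) (x / m)))

  sumTo-shift : ∀ m h → Periodic m h → ∀ c → sumTo m (λ i → h (i ℕ.+ c)) ≡ sumTo m h
  sumTo-shift m h P zero    = sumTo-ext m (λ i → cong h (ℕP.+-identityʳ i))
  sumTo-shift m h P (suc c) = begin
    sumTo m (λ i → h (i ℕ.+ suc c))     ≡⟨ sumTo-ext m (λ i → cong h (ℕP.+-suc i c)) ⟩
    sumTo m (λ i → h (suc i ℕ.+ c))     ≡⟨ sumTo-shift m (λ i → h (suc i)) (λ i → P (suc i)) c ⟩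
    sumTo m (λ i → h (suc i))           ≡⟨ +-cancelʳ (h 0) _ _ rotate ⟩
    sumTo m h                           ∎
    where
    open ≡-Reasoning
    rotate : sumTo m (λ i → h (suc i)) + h 0 ≡ sumTo m h + h 0
    rotate = trans (ℤP.+-comm _ (h 0))
      (trans (sym (sumTo-suc m h)) (cong (λ z → sumTo m h + z) (P 0)))

  correlation : ℕ → (ℕ → ℤ) → ℕ → ℤ
  correlation n f t = sumTo n (λ i → f i * f (i ℕ.+ t))

  TwoLevel : ℕ → (ℕ → ℤ) → ℤ → Set
  TwoLevel d f M = correlation (suc d) f 0 ≡ M * + d
                 × (∀ s → 1 ≤ s → s < suc d → correlation (suc d) f s ≡ - M)

  record Cyclic (m : ℕ) : Set where
    constructor cyclic
    field
      at       : ℕ → ℤ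
      periodic : Periodic m at
  open Cyclic public

  divide-cyclic : ∀ {m} c .{{_ : ℤ.NonZero c}} (f : Cyclic m) → (∀ i → c ∣ₛ at f i) →
    Σ (Cyclic m) λ g → ∀ i → at f i ≡ at g i * c
  divide-cyclic c f c∣f = cyclic quotient quotient-periodic , equality
    where
    quotient : ℕ → ℤ
    quotient i = ℤD._∣_.quotient (c∣f i)
    equality : ∀ i → at f i ≡ quotient i * c
    equality i = ℤD._∣_.equality (c∣f i)
    quotient-periodic : Periodic _ quotient
    quotient-periodic i =
      ℤP.*-cancelʳ-≡ _ _ c (trans (sym (equality (i ℕ.+ _))) (trans (periodic f i) (equality i)))

  correlation-periodic : ∀ n {m f} → Periodic m f → Periodic m (correlation n f)
  correlation-periodic n {m} {f} P t =
    sumTo-ext n (λ i → cong (f i *_) (trans (cong f (sym (ℕP.+-assoc i t m))) (P (i ℕ.+ t))))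

  correlation-scale : ∀ n {f g} c → (∀ i → f i ≡ g i * c) →
    ∀ t → correlation n f t ≡ correlation n g t * (c * c)
  correlation-scale n {f} {g} c f≡g*c t =
    trans (sumTo-ext n (λ i → trans (cong₂ _*_ (f≡g*c i) (f≡g*c (i ℕ.+ t))) (regroup (g i) (g (i ℕ.+ t)) c)))
          (sumTo-*ʳ n (c * c) (λ i → g i * g (i ℕ.+ t)))
    where
    regroup : ∀ a b c → (a * c) * (b * c) ≡ (a * b) * (c * c)
    regroup = solve-∀

  sumTo-correlation : ∀ m X → Periodic m X → sumTo m (correlation m X) ≡ sumTo m X * sumTo m X
  sumTo-correlation m X P = begin
    sumTo m (λ s → sumTo m (λ j → X j * X (j ℕ.+ s)))
      ≡⟨ sumTo-swap m m (λ s j → X j * X (j ℕ.+ s)) ⟩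
    sumTo m (λ j → sumTo m (λ s → X j * X (j ℕ.+ s)))
      ≡⟨ sumTo-ext m (λ j → sumTo-*ˡ m (X j) (λ s → X (j ℕ.+ s))) ⟩
    sumTo m (λ j → X j * sumTo m (λ s → X (j ℕ.+ s)))
      ≡⟨ sumTo-ext m (λ j → cong (X j *_) (shifted-sum j)) ⟩
    sumTo m (λ j → X j * sumTo m X)
      ≡⟨ sumTo-*ʳ m (sumTo m X) X ⟩
    sumTo m X * sumTo m X ∎
    where
    open ≡-Reasoning
    shifted-sum : ∀ j → sumTo m (λ s → X (j ℕ.+ s)) ≡ sumTo m X
    shifted-sum j = trans (sumTo-ext m (λ s → cong X (ℕP.+-comm j s))) (sumTo-shift m X P j)

  correlation-centered : ∀ m X → Periodic m X → ∀ s →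
    correlation m (λ j → + m * X j - sumTo m X) s
      ≡ (+ m * + m) * correlation m X s - + m * (sumTo m X * sumTo m X)
  correlation-centered m X P s = begin
    sumTo m (λ j → (E * X j - K) * (E * X (j ℕ.+ s) - K))
      ≡⟨ sumTo-ext m (λ j → expand E (X j) (X (j ℕ.+ s)) K) ⟩
    sumTo m (λ j → (E * E * C j + L * X (j ℕ.+ s)) + (L * X j + K * K))
      ≡⟨ sumTo-+ m (λ j → E * E * C j + L * X (j ℕ.+ s)) (λ j → L * X j + K * K) ⟩
    sumTo m (λ j → E * E * C j + L * X (j ℕ.+ s)) + sumTo m (λ j → L * X j + K * K)
      ≡⟨ cong₂ _+_ (sumTo-+ m (λ j → E * E * C j) (λ j → L * X (j ℕ.+ s)))
                   (sumTo-+ m (λ j → L * X j) (λ _ → K * K)) ⟩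
    (sumTo m (λ j → E * E * C j) + sumTo m (λ j → L * X (j ℕ.+ s)))
      + (sumTo m (λ j → L * X j) + sumTo m (λ _ → K * K))
      ≡⟨ cong₂ _+_ (cong₂ _+_ (sumTo-*ˡ m (E * E) C)
                              (trans (sumTo-*ˡ m L (λ j → X (j ℕ.+ s))) (cong (L *_) (sumTo-shift m X P s))))
                   (cong₂ _+_ (sumTo-*ˡ m L X) (sumTo-const m (K * K))) ⟩
    (E * E * correlation m X s + L * K) + (L * K + E * (K * K))
      ≡⟨ collect E (correlation m X s) K ⟩
    E * E * correlation m X s - E * (K * K) ∎
    where
    open ≡-Reasoning
    E K L : ℤ
    E = + m
    K = sumTo m X
    L = - (E * K)
    C : ℕ → ℤ
    C j = X j * X (j ℕ.+ s)
    expand : ∀ E a b k → (E * a - k) * (E * b - k) ≡ (E * E * (a * b) + - (E * k) * b) + (- (E * k) * a + k * k)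
    expand = solve-∀
    collect : ∀ E c k → (E * E * c + - (E * k) * k) + (- (E * k) * k + E * (k * k)) ≡ E * E * c - E * (k * k)
    collect = solve-∀

open PeriodicFunctions

module Modular (p : ℕ) where

  open import Data.Integer using (_+_; _*_; _-_; 0ℤ; 1ℤ)

  infix 4 _≡ₚ_
  record _≡ₚ_ (x y : ℤ) : Set where
    constructor mod-p
    field p∣x-y : + p ∣ₛ (x - y)
  open _≡ₚ_ public

  ≡⇒≡ₚ : ∀ {x y} → x ≡ y → x ≡ₚ y
  ≡⇒≡ₚ {x} refl = mod-p (divides 0ℤ (ℤP.+-inverseʳ x))

  ≡ₚ-sym : ∀ {x y} → x ≡ₚ y → y ≡ₚ x
  ≡ₚ-sym {x} {y} (mod-p h) = mod-p (subst (+ p ∣ₛ_) (negate x y) (ℤD.∣m⇒∣-m h))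
    where
    negate : ∀ x y → - (x - y) ≡ y - x
    negate = solve-∀

  ≡ₚ-trans : ∀ {x y z} → x ≡ₚ y → y ≡ₚ z → x ≡ₚ z
  ≡ₚ-trans {x} {y} {z} (mod-p h) (mod-p k) =
    mod-p (subst (+ p ∣ₛ_) (ℤP.+-minus-telescope x y z) (ℤD.∣m∣n⇒∣m+n h k))

  +-congₚ : ∀ {x y u v} → x ≡ₚ y → u ≡ₚ v → x + u ≡ₚ y + v
  +-congₚ {x} {y} {u} {v} (mod-p h) (mod-p k) =
    mod-p (subst (+ p ∣ₛ_) (regroup x y u v) (ℤD.∣m∣n⇒∣m+n h k))
    where
    regroup : ∀ a b c d → (a - b) + (c - d) ≡ (a + c) - (b + d)
    regroup = solve-∀

  *-congₚ : ∀ {x y u v} → x ≡ₚ y → u ≡ₚ v → x * u ≡ₚ y * v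
  *-congₚ {x} {y} {u} {v} (mod-p h) (mod-p k) =
    mod-p (subst (+ p ∣ₛ_) (regroup x y u v) (ℤD.∣m∣n⇒∣m+n (ℤD.∣m⇒∣m*n u h) (ℤD.∣n⇒∣m*n y k)))
    where
    regroup : ∀ a b c d → (a - b) * c + b * (c - d) ≡ a * c - b * d
    regroup = solve-∀

  +-cancelʳₚ : ∀ {x y} u → x + u ≡ₚ y + u → x ≡ₚ y
  +-cancelʳₚ {x} {y} u (mod-p h) = mod-p (subst (+ p ∣ₛ_) (cancel x y u) h)
    where
    cancel : ∀ x y u → (x + u) - (y + u) ≡ x - y
    cancel = solve-∀

  sumTo-congₚ : ∀ n {f g} → (∀ i → f i ≡ₚ g i) → sumTo n f ≡ₚ sumTo n g
  sumTo-congₚ zero    h = ≡⇒≡ₚ refl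
  sumTo-congₚ (suc n) h = +-congₚ (sumTo-congₚ n h) (h n)

  ℤ/p-isCommutativeSemiring : IsCommutativeSemiring _≡ₚ_ _+_ _*_ 0ℤ 1ℤ
  ℤ/p-isCommutativeSemiring = IsCommutativeSemiringˡ.isCommutativeSemiring record
    { +-isCommutativeMonoid = record
      { isMonoid = record
        { isSemigroup = record
          { isMagma = record { isEquivalence = ≡ₚ-isEquivalence ; ∙-cong = +-congₚ }
          ; assoc = λ x y z → ≡⇒≡ₚ (ℤP.+-assoc x y z) }
        ; identity = (λ x → ≡⇒≡ₚ (ℤP.+-identityˡ x)) , (λ x → ≡⇒≡ₚ (ℤP.+-identityʳ x)) }
      ; comm = λ x y → ≡⇒≡ₚ (ℤP.+-comm x y) }
    ; *-isCommutativeMonoid = record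
      { isMonoid = record
        { isSemigroup = record
          { isMagma = record { isEquivalence = ≡ₚ-isEquivalence ; ∙-cong = *-congₚ }
          ; assoc = λ x y z → ≡⇒≡ₚ (ℤP.*-assoc x y z) }
        ; identity = (λ x → ≡⇒≡ₚ (ℤP.*-identityˡ x)) , (λ x → ≡⇒≡ₚ (ℤP.*-identityʳ x)) }
      ; comm = λ x y → ≡⇒≡ₚ (ℤP.*-comm x y) }
    ; distribʳ = λ x y z → ≡⇒≡ₚ (ℤP.*-distribʳ-+ x y z)
    ; zeroˡ    = λ x → ≡⇒≡ₚ (ℤP.*-zeroˡ x)
    }
    where
    ≡ₚ-isEquivalence : IsEquivalence _≡ₚ_
    ≡ₚ-isEquivalence = record { refl = ≡⇒≡ₚ refl ; sym = ≡ₚ-sym ; trans = ≡ₚ-trans }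

  ℤ/p : CommutativeSemiring 0ℓ 0ℓ
  ℤ/p = record { isCommutativeSemiring = ℤ/p-isCommutativeSemiring }

module Binomial where

  [1+k]*[1+n]C[1+k]≡[1+n]*nCk : ∀ n k → suc k ℕ.* (suc n C suc k) ≡ suc n ℕ.* (n C k)
  [1+k]*[1+n]C[1+k]≡[1+n]*nCk zero zero    = refl
  [1+k]*[1+n]C[1+k]≡[1+n]*nCk zero (suc k) = begin
    suc (suc k) ℕ.* (1 C suc (suc k))  ≡⟨ cong (suc (suc k) ℕ.*_) (k>n⇒nCk≡0 {1} {suc (suc k)} (ℕP.m≤m+n 2 k)) ⟩
    suc (suc k) ℕ.* 0                  ≡⟨ ℕP.*-zeroʳ (suc (suc k)) ⟩
    0                                  ≡⟨ cong (1 ℕ.*_) (k>n⇒nCk≡0 {0} {suc k} (ℕP.m≤m+n 1 k)) ⟨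
    1 ℕ.* (0 C suc k)                  ∎
    where open ≡-Reasoning
  [1+k]*[1+n]C[1+k]≡[1+n]*nCk (suc n) zero =
    trans (ℕP.*-identityˡ _) (trans (nC1≡n (suc (suc n))) (sym (ℕP.*-identityʳ _)))
  [1+k]*[1+n]C[1+k]≡[1+n]*nCk (suc n) (suc k) = begin
    suc (suc k) ℕ.* (suc (suc n) C suc (suc k))
      ≡⟨ cong (suc (suc k) ℕ.*_) (sym (nCk+nC[k+1]≡[n+1]C[k+1] (suc n) (suc k))) ⟩
    suc (suc k) ℕ.* (A ℕ.+ B)
      ≡⟨ distribute k A B ⟩
    A ℕ.+ suc k ℕ.* A ℕ.+ suc (suc k) ℕ.* B
      ≡⟨ cong₂ (λ u v → A ℕ.+ u ℕ.+ v) ([1+k]*[1+n]C[1+k]≡[1+n]*nCk n k)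
                                       ([1+k]*[1+n]C[1+k]≡[1+n]*nCk n (suc k)) ⟩
    A ℕ.+ suc n ℕ.* (n C k) ℕ.+ suc n ℕ.* (n C suc k)
      ≡⟨ collect A n (n C k) (n C suc k) ⟩
    A ℕ.+ suc n ℕ.* (n C k ℕ.+ n C suc k)
      ≡⟨ cong (λ z → A ℕ.+ suc n ℕ.* z) (nCk+nC[k+1]≡[n+1]C[k+1] n k) ⟩
    suc (suc n) ℕ.* A ∎
    where
    open ≡-Reasoning
    A B : ℕ
    A = suc n C suc k
    B = suc n C suc (suc k)
    distribute : ∀ k A B → suc (suc k) ℕ.* (A ℕ.+ B) ≡ A ℕ.+ suc k ℕ.* A ℕ.+ suc (suc k) ℕ.* B
    distribute = ℕSolver.solve-∀
    collect : ∀ A n X Y → A ℕ.+ suc n ℕ.* X ℕ.+ suc n ℕ.* Y ≡ A ℕ.+ suc n ℕ.* (X ℕ.+ Y)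
    collect = ℕSolver.solve-∀

  p∣pCk : ∀ {p k} → Prime p → 0 < k → k < p → p ∣ (p C k)
  p∣pCk {suc n} {suc k} p-prime _ k<p
    with euclidsLemma (suc k) (suc n C suc k) p-prime
           (subst (suc n ∣_) (sym ([1+k]*[1+n]C[1+k]≡[1+n]*nCk n k)) (ℕDiv.m∣m*n (n C k)))
  ... | inj₂ p∣pCk = p∣pCk
  ... | inj₁ p∣k   = ⊥-elim (ℕP.<⇒≱ k<p (ℕDiv.∣⇒≤ p∣k))

open Binomial

module Frobenius {a ℓ} (S : CommutativeSemiring a ℓ) where

  open CommutativeSemiring S renaming (refl to ≈-refl; sym to ≈-sym; trans to ≈-trans)
  open import Algebra.Properties.CommutativeSemiring.Binomial S
    using (theorem; binomialExpansion; binomialTerm; binomial)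
  open import Algebra.Properties.Semiring.Exp semiring using (_^_; ^-congʳ)
  open import Algebra.Properties.Monoid.Mult +-monoid
    using (×-assocˡ; ×-congʳ; ×-congˡ; ×-homo-1) renaming (_×_ to _×ᴹ_)
  open import Algebra.Properties.Monoid.Sum +-monoid
    using (sum; sum-init-last; sum-cong-≋; sum-replicate-zero)
  open import Relation.Binary.Reasoning.Setoid setoid

  module _ {p : ℕ} (prime : Prime p) (characteristic : ∀ x → p ×ᴹ x ≈ 0#) where

    ×-zeroʳ : ∀ m → m ×ᴹ 0# ≈ 0#
    ×-zeroʳ zero    = ≈-refl
    ×-zeroʳ (suc m) = ≈-trans (+-identityˡ _) (×-zeroʳ m)

    multiple-×≈0 : ∀ m x → (m ℕ.* p) ×ᴹ x ≈ 0#
    multiple-×≈0 m x = begin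
      (m ℕ.* p) ×ᴹ x  ≈⟨ ×-assocˡ x m p ⟨
      m ×ᴹ (p ×ᴹ x)   ≈⟨ ×-congʳ m (characteristic x) ⟩
      m ×ᴹ 0#         ≈⟨ ×-zeroʳ m ⟩
      0#              ∎

    pCk×≈0 : ∀ k x → 0 < k → k < p → (p C k) ×ᴹ x ≈ 0#
    pCk×≈0 k x 0<k k<p with p∣pCk prime 0<k k<p
    ... | ℕDiv.divides m pCk≡m*p = ≈-trans (×-congˡ pCk≡m*p) (multiple-×≈0 m x)

    -- Writing p = q + 2 separates the outer binomial terms x^p, y^p from the inner ones, all ≈ 0.
    frobenius′ : ∀ q → suc (suc q) ≡ p → ∀ x y → (x + y) ^ p ≈ x ^ p + y ^ p
    frobenius′ q refl x y = begin
      (x + y) ^ p                 ≈⟨ theorem p x y ⟩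
      binomialExpansion x y p     ≈⟨ +-congˡ (sum-init-last (λ i → term (Fin.suc i))) ⟩
      term Fin.zero + (sum (λ i → term (Fin.suc (inject₁ i))) + term (Fin.suc (fromℕ (suc q))))
        ≈⟨ +-cong first (+-cong (≈-trans (sum-cong-≋ inner) (sum-replicate-zero (suc q))) last) ⟩
      y ^ p + (0# + x ^ p)        ≈⟨ ≈-trans (+-congˡ (+-identityˡ _)) (+-comm _ _) ⟩
      x ^ p + y ^ p               ∎
      where
      term : Fin.Fin (suc p) → Carrier
      term = binomialTerm x y p
      first : term Fin.zero ≈ y ^ p
      first = ≈-trans (+-identityʳ _) (*-identityˡ _)
      top : toℕ (Fin.suc (fromℕ (suc q))) ≡ p
      top = cong suc (FinP.toℕ-fromℕ (suc q))
      last : term (Fin.suc (fromℕ (suc q))) ≈ x ^ p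
      last = begin
        term (Fin.suc (fromℕ (suc q)))
          ≈⟨ ×-congˡ (trans (cong (p C_) top) (nCn≡1 p)) ⟩
        1 ×ᴹ binomial x y p (Fin.suc (fromℕ (suc q)))
          ≈⟨ ×-homo-1 _ ⟩
        x ^ toℕ (Fin.suc (fromℕ (suc q))) * y ^ (p ∸ toℕ (Fin.suc (fromℕ (suc q))))
          ≈⟨ *-cong (^-congʳ x top) (^-congʳ y (trans (cong (p ∸_) top) (ℕP.n∸n≡0 p))) ⟩
        x ^ p * 1#
          ≈⟨ *-identityʳ _ ⟩
        x ^ p ∎
      inner : ∀ i → term (Fin.suc (inject₁ i)) ≈ 0#
      inner i = pCk×≈0 (suc (toℕ (inject₁ i))) _ (s≤s z≤n)
        (s≤s (subst (_< suc q) (sym (FinP.toℕ-inject₁ i)) (FinP.toℕ<n i)))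

    frobenius : ∀ x y → (x + y) ^ p ≈ x ^ p + y ^ p
    frobenius = frobenius′ (p ∸ 2) (ℕP.m+[n∸m]≡n (ℕ.nonTrivial⇒n>1 p {{prime⇒nonTrivial prime}}))

module Fermat {p : ℕ} (prime : Prime p) where

  open import Data.Integer using (_+_; _*_; _^_; 0ℤ; 1ℤ; -[1+_])
  open Modular p
  open import Algebra.Properties.Monoid.Mult (CommutativeSemiring.+-monoid ℤ/p)
    using () renaming (_×_ to _×ᴹ_)
  open import Algebra.Properties.Semiring.Exp (CommutativeSemiring.semiring ℤ/p)
    using () renaming (_^_ to _^ᴹ_)
  open import Relation.Binary.Reasoning.Setoid (CommutativeSemiring.setoid ℤ/p)

  ^ᴹ≡^ : ∀ x n → x ^ᴹ n ≡ x ^ n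
  ^ᴹ≡^ x zero    = refl
  ^ᴹ≡^ x (suc n) = cong (x *_) (^ᴹ≡^ x n)

  ×ᴹ≡* : ∀ n x → n ×ᴹ x ≡ + n * x
  ×ᴹ≡* zero    x = refl
  ×ᴹ≡* (suc n) x = trans (cong (λ z → x + z) (×ᴹ≡* n x)) (sym (ℤP.suc-* (+ n) x))

  characteristic : ∀ x → p ×ᴹ x ≡ₚ 0ℤ
  characteristic x = mod-p (subst (+ p ∣ₛ_) (sym (trans (ℤP.+-identityʳ _) (×ᴹ≡* p x)))
                                  (ℤD.∣m⇒∣m*n x ℤD.∣-refl))

  frobenius : ∀ x y → (x + y) ^ p ≡ₚ x ^ p + y ^ p
  frobenius x y = subst₂ _≡ₚ_ (^ᴹ≡^ (x + y) p) (cong₂ _+_ (^ᴹ≡^ x p) (^ᴹ≡^ y p))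
    (Frobenius.frobenius ℤ/p prime characteristic x y)

  0^p≡0 : 0ℤ ^ p ≡ 0ℤ
  0^p≡0 = subst (λ m → 0ℤ ^ m ≡ 0ℤ) (ℕP.m+[n∸m]≡n 1≤p) refl
    where
    1≤p : 1 ≤ p
    1≤p = ℕP.<⇒≤ (ℕ.nonTrivial⇒n>1 p {{prime⇒nonTrivial prime}})

  fermat-ℕ : ∀ n → (+ n) ^ p ≡ₚ + n
  fermat-ℕ zero    = ≡⇒≡ₚ 0^p≡0
  fermat-ℕ (suc n) = begin
    (+ suc n) ^ p        ≡⟨ cong (_^ p) suc≡+1 ⟩
    (+ n + 1ℤ) ^ p       ≈⟨ frobenius (+ n) 1ℤ ⟩
    (+ n) ^ p + 1ℤ ^ p   ≈⟨ +-congₚ (fermat-ℕ n) (≡⇒≡ₚ (ℤP.^-zeroˡ p)) ⟩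
    + n + 1ℤ             ≡⟨ suc≡+1 ⟨
    + suc n              ∎
    where
    suc≡+1 : + suc n ≡ + n + 1ℤ
    suc≡+1 = trans (cong +_ (ℕP.+-comm 1 n)) (ℤP.pos-+ n 1)

  fermat : ∀ c → c ^ p ≡ₚ c
  fermat (+ n)      = fermat-ℕ n
  fermat -[1+ n ]   = +-cancelʳₚ (+ suc n) (begin
    x ^ p + + suc n      ≈⟨ +-congₚ (≡⇒≡ₚ {x ^ p} refl) (fermat-ℕ (suc n)) ⟨
    x ^ p + (+ suc n) ^ p ≈⟨ frobenius x (+ suc n) ⟨
    (x + + suc n) ^ p    ≡⟨ cong (_^ p) (ℤP.+-inverseˡ (+ suc n)) ⟩
    0ℤ ^ p               ≡⟨ 0^p≡0 ⟩
    0ℤ                   ≡⟨ ℤP.+-inverseˡ (+ suc n) ⟨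
    x + + suc n          ∎)
    where
    x : ℤ
    x = -[1+ n ]

module GroupRing (d p : ℕ) where

  open import Data.Integer using (_+_; _*_; _-_; _^_; 0ℤ; 1ℤ)
  open Modular p

  e : ℕ
  e = suc d

  infixl 6 _⊕_
  infixl 7 _⊛_
  infix  4 _≈_ _≐_

  _⊕_ : Cyclic e → Cyclic e → Cyclic e
  f ⊕ g = cyclic (λ i → at f i + at g i) (λ i → cong₂ _+_ (periodic f i) (periodic g i))

  𝟘 : Cyclic e
  𝟘 = cyclic (λ _ → 0ℤ) (λ _ → refl)

  -- Cyclic convolution Σᵢ f(i) g(s - i), written with d·i ≡ -i (mod e) to avoid subtraction.
  convolution : (ℕ → ℤ) → (ℕ → ℤ) → ℕ → ℤ
  convolution f g s = sumTo e (λ i → f i * g (s ℕ.+ d ℕ.* i))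

  convolution-periodic : ∀ f g → Periodic e g → Periodic e (convolution f g)
  convolution-periodic f g P s =
    sumTo-ext e (λ i → cong (f i *_) (trans (cong g (shuffle d s i)) (P _)))
    where
    shuffle : ∀ d s i → s ℕ.+ suc d ℕ.+ d ℕ.* i ≡ s ℕ.+ d ℕ.* i ℕ.+ suc d
    shuffle = ℕSolver.solve-∀

  _⊛_ : Cyclic e → Cyclic e → Cyclic e
  f ⊛ g = cyclic (convolution (at f) (at g)) (convolution-periodic (at f) (at g) (periodic g))

  monomialAt : ℕ → ℤ → ℕ → ℤ
  monomialAt a c i = if i % e ℕ.≡ᵇ a % e then c else 0ℤ

  monomial : ℕ → ℤ → Cyclic e
  monomial a c = cyclic (monomialAt a c)
    (λ i → cong (λ r → if r ℕ.≡ᵇ a % e then c else 0ℤ) (ℕD.[m+n]%n≡m%n i e))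

  monomialAt-≡ : ∀ a c i → i % e ≡ a % e → monomialAt a c i ≡ c
  monomialAt-≡ a c i eq with i % e ℕ.≡ᵇ a % e | ℕP.≡⇒≡ᵇ (i % e) (a % e) eq
  ... | true | _ = refl

  monomialAt-≢ : ∀ a c i → ¬ i % e ≡ a % e → monomialAt a c i ≡ 0ℤ
  monomialAt-≢ a c i ne with i % e ℕ.≡ᵇ a % e | ℕP.≡ᵇ⇒≡ (i % e) (a % e)
  ... | true  | eq = ⊥-elim (ne (eq tt))
  ... | false | _  = refl

  𝟙 : Cyclic e
  𝟙 = monomial 0 1ℤ

  _≐_ : Cyclic e → Cyclic e → Set
  f ≐ g = ∀ i → at f i ≡ at g i

  record _≈_ (f g : Cyclic e) : Set where
    constructor pointwise
    field at-≡ₚ : ∀ i → at f i ≡ₚ at g i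
  open _≈_ public

  ≐⇒≈ : ∀ {f g} → f ≐ g → f ≈ g
  ≐⇒≈ h = pointwise (λ i → ≡⇒≡ₚ (h i))

  ≈-refl : ∀ {f} → f ≈ f
  ≈-refl = ≐⇒≈ (λ _ → refl)

  ≈-sym : ∀ {f g} → f ≈ g → g ≈ f
  ≈-sym (pointwise h) = pointwise (λ i → ≡ₚ-sym (h i))

  ≈-isEquivalence : IsEquivalence _≈_
  ≈-isEquivalence = record
    { refl  = ≈-refl
    ; sym   = ≈-sym
    ; trans = λ (pointwise h) (pointwise k) → pointwise (λ i → ≡ₚ-trans (h i) (k i))
    }

  ⊕-cong : ∀ {f g u v} → f ≈ g → u ≈ v → f ⊕ u ≈ g ⊕ v
  ⊕-cong (pointwise h) (pointwise k) = pointwise (λ i → +-congₚ (h i) (k i))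

  ⊛-cong : ∀ {f g u v} → f ≈ g → u ≈ v → f ⊛ u ≈ g ⊛ v
  ⊛-cong (pointwise h) (pointwise k) =
    pointwise (λ s → sumTo-congₚ e (λ i → *-congₚ (h i) (k (s ℕ.+ d ℕ.* i))))

  ⊕-congʳ : ∀ {f g} h → f ≈ g → f ⊕ h ≈ g ⊕ h
  ⊕-congʳ h f≈g = ⊕-cong f≈g (≈-refl {h})

  ⊛-congˡ : ∀ f {g h} → g ≈ h → f ⊛ g ≈ f ⊛ h
  ⊛-congˡ f g≈h = ⊛-cong (≈-refl {f}) g≈h

  ⊛-congʳ : ∀ {f g} h → f ≈ g → f ⊛ h ≈ g ⊛ h
  ⊛-congʳ h f≈g = ⊛-cong f≈g (≈-refl {h})

  sumTo-reflect : ∀ h → Periodic e h → sumTo e (λ i → h (d ℕ.* i)) ≡ sumTo e h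
  sumTo-reflect h P = sym (begin
    sumTo e h                        ≡⟨ sumTo-shift e h P 1 ⟨
    sumTo e (λ i → h (i ℕ.+ 1))      ≡⟨ sumTo-ext e (λ i → cong h (ℕP.+-comm i 1)) ⟩
    sumTo e (λ i → h (suc i))        ≡⟨ sumTo-reverse e (λ i → h (suc i)) ⟩
    sumTo e (λ i → h (suc (d ∸ i)))  ≡⟨ sumTo-cong e (λ i i<e → periodic-≡ P _ _ i 1 (reflect d i i<e)) ⟩
    sumTo e (λ i → h (d ℕ.* i))      ∎)
    where
    open ≡-Reasoning
    reflect′ : ∀ i r → suc r ℕ.+ i ℕ.* suc (i ℕ.+ r) ≡ (i ℕ.+ r) ℕ.* i ℕ.+ 1 ℕ.* suc (i ℕ.+ r)
    reflect′ = ℕSolver.solve-∀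
    reflect : ∀ D i → i < suc D → suc (D ∸ i) ℕ.+ i ℕ.* suc D ≡ D ℕ.* i ℕ.+ 1 ℕ.* suc D
    reflect D i (s≤s i≤D) with D ∸ i | ℕP.m+[n∸m]≡n i≤D
    ... | r | refl = reflect′ i r

  sumTo-affine : ∀ h → Periodic e h → ∀ c → sumTo e (λ i → h (c ℕ.+ d ℕ.* i)) ≡ sumTo e h
  sumTo-affine h P c = begin
    sumTo e (λ i → h (c ℕ.+ d ℕ.* i))  ≡⟨ sumTo-ext e (λ i → cong h (ℕP.+-comm c (d ℕ.* i))) ⟩
    sumTo e (λ i → h (d ℕ.* i ℕ.+ c))  ≡⟨ sumTo-reflect (λ x → h (x ℕ.+ c)) shifted-periodic ⟩
    sumTo e (λ i → h (i ℕ.+ c))        ≡⟨ sumTo-shift e h P c ⟩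
    sumTo e h                          ∎
    where
    open ≡-Reasoning
    shuffle : ∀ x c → x ℕ.+ e ℕ.+ c ≡ x ℕ.+ c ℕ.+ e
    shuffle x c = trans (ℕP.+-assoc x e c) (trans (cong (x ℕ.+_) (ℕP.+-comm e c)) (sym (ℕP.+-assoc x c e)))
    shifted-periodic : Periodic e (λ x → h (x ℕ.+ c))
    shifted-periodic x = trans (cong h (shuffle x c)) (P (x ℕ.+ c))

  ⊕-assoc : ∀ f g h → (f ⊕ g) ⊕ h ≐ f ⊕ (g ⊕ h)
  ⊕-assoc f g h i = ℤP.+-assoc (at f i) (at g i) (at h i)

  ⊕-comm : ∀ f g → f ⊕ g ≐ g ⊕ f
  ⊕-comm f g i = ℤP.+-comm (at f i) (at g i)

  ⊕-identityˡ : ∀ f → 𝟘 ⊕ f ≐ f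
  ⊕-identityˡ f i = ℤP.+-identityˡ (at f i)

  ⊕-identityʳ : ∀ f → f ⊕ 𝟘 ≐ f
  ⊕-identityʳ f i = ℤP.+-identityʳ (at f i)

  ⊛-zeroˡ : ∀ f → 𝟘 ⊛ f ≐ 𝟘
  ⊛-zeroˡ f s = sumTo-zero e

  ⊛-distribʳ : ∀ f g h → (g ⊕ h) ⊛ f ≐ g ⊛ f ⊕ h ⊛ f
  ⊛-distribʳ f g h s =
    trans (sumTo-ext e (λ i → ℤP.*-distribʳ-+ (at f (s ℕ.+ d ℕ.* i)) (at g i) (at h i))) (sumTo-+ e _ _)

  ⊛-comm : ∀ f g → f ⊛ g ≐ g ⊛ f
  ⊛-comm f g s = trans (sumTo-ext e swap) (sumTo-affine term term-periodic s)
    where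
    term : ℕ → ℤ
    term i = at g i * at f (s ℕ.+ d ℕ.* i)
    shift : ∀ d s i → s ℕ.+ d ℕ.* (i ℕ.+ suc d) ≡ s ℕ.+ d ℕ.* i ℕ.+ d ℕ.* suc d
    shift = ℕSolver.solve-∀
    term-periodic : Periodic e term
    term-periodic i =
      cong₂ _*_ (periodic g i) (trans (cong (at f) (shift d s i)) (periodic-+* (periodic f) _ d))
    involution : ∀ d s i →
      s ℕ.+ d ℕ.* (s ℕ.+ d ℕ.* i) ℕ.+ i ℕ.* suc d ≡ i ℕ.+ (s ℕ.+ d ℕ.* i) ℕ.* suc d
    involution = ℕSolver.solve-∀
    swap : ∀ i → at f i * at g (s ℕ.+ d ℕ.* i)
               ≡ at g (s ℕ.+ d ℕ.* i) * at f (s ℕ.+ d ℕ.* (s ℕ.+ d ℕ.* i))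
    swap i = trans (ℤP.*-comm (at f i) _)
      (cong (at g (s ℕ.+ d ℕ.* i) *_) (sym (periodic-≡ (periodic f) _ i i (s ℕ.+ d ℕ.* i) (involution d s i))))

  ⊛-assoc : ∀ f g h → (f ⊛ g) ⊛ h ≐ f ⊛ (g ⊛ h)
  ⊛-assoc f g h s = begin
    sumTo e (λ i → convolution (at f) (at g) i * at h (s ℕ.+ d ℕ.* i))
      ≡⟨ sumTo-ext e (λ i → sumTo-*ʳ e (at h (s ℕ.+ d ℕ.* i)) (λ j → at f j * at g (i ℕ.+ d ℕ.* j))) ⟨
    sumTo e (λ i → sumTo e (λ j → at f j * at g (i ℕ.+ d ℕ.* j) * at h (s ℕ.+ d ℕ.* i)))
      ≡⟨ sumTo-swap e e (λ i j → at f j * at g (i ℕ.+ d ℕ.* j) * at h (s ℕ.+ d ℕ.* i)) ⟩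
    sumTo e (λ j → sumTo e (λ i → at f j * at g (i ℕ.+ d ℕ.* j) * at h (s ℕ.+ d ℕ.* i)))
      ≡⟨ sumTo-ext e (λ j → trans (inner j) (sumTo-*ˡ e (at f j) _)) ⟩
    sumTo e (λ j → at f j * convolution (at g) (at h) (s ℕ.+ d ℕ.* j))
      ∎
    where
    open ≡-Reasoning
    term : ℕ → ℕ → ℤ
    term j i = at f j * (at g i * at h (s ℕ.+ d ℕ.* j ℕ.+ d ℕ.* i))
    shift : ∀ d s j i →
      s ℕ.+ d ℕ.* j ℕ.+ d ℕ.* (i ℕ.+ suc d) ≡ s ℕ.+ d ℕ.* j ℕ.+ d ℕ.* i ℕ.+ d ℕ.* suc d
    shift = ℕSolver.solve-∀
    term-periodic : ∀ j → Periodic e (term j)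
    term-periodic j i = cong (at f j *_)
      (cong₂ _*_ (periodic g i) (trans (cong (at h) (shift d s j i)) (periodic-+* (periodic h) _ d)))
    reindex : ∀ d s j i → s ℕ.+ d ℕ.* j ℕ.+ d ℕ.* (i ℕ.+ d ℕ.* j) ℕ.+ 0 ℕ.* suc d
                        ≡ s ℕ.+ d ℕ.* i ℕ.+ (d ℕ.* j) ℕ.* suc d
    reindex = ℕSolver.solve-∀
    inner : ∀ j → sumTo e (λ i → at f j * at g (i ℕ.+ d ℕ.* j) * at h (s ℕ.+ d ℕ.* i)) ≡ sumTo e (term j)
    inner j = trans
      (sumTo-ext e (λ i → trans (ℤP.*-assoc (at f j) _ _)
        (cong (λ w → at f j * (at g (i ℕ.+ d ℕ.* j) * w))
              (sym (periodic-≡ (periodic h) _ _ 0 (d ℕ.* j) (reindex d s j i))))))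
      (sumTo-shift e (term j) (term-periodic j) (d ℕ.* j))

  ⊛-identityˡ : ∀ f → 𝟙 ⊛ f ≐ f
  ⊛-identityˡ f s = begin
    sumTo e (λ i → monomialAt 0 1ℤ i * at f (s ℕ.+ d ℕ.* i))  ≡⟨ sumTo-single e _ 0 (s≤s z≤n) off-zero ⟩
    1ℤ * at f (s ℕ.+ d ℕ.* 0)                                ≡⟨ ℤP.*-identityˡ _ ⟩
    at f (s ℕ.+ d ℕ.* 0)                                     ≡⟨ cong (λ k → at f (s ℕ.+ k)) (ℕP.*-zeroʳ d) ⟩
    at f (s ℕ.+ 0)                                           ≡⟨ cong (at f) (ℕP.+-identityʳ s) ⟩
    at f s                                                   ∎
    where
    open ≡-Reasoning
    off-zero : ∀ i → i < e → ¬ i ≡ 0 → monomialAt 0 1ℤ i * at f (s ℕ.+ d ℕ.* i) ≡ 0ℤ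
    off-zero i i<e i≢0 = cong (_* at f (s ℕ.+ d ℕ.* i))
      (monomialAt-≢ 0 1ℤ i (λ eq → i≢0 (trans (sym (ℕD.m<n⇒m%n≡m i<e)) eq)))

  ℤ[Cₑ]/p-isCommutativeSemiring : IsCommutativeSemiring _≈_ _⊕_ _⊛_ 𝟘 𝟙
  ℤ[Cₑ]/p-isCommutativeSemiring = IsCommutativeSemiringˡ.isCommutativeSemiring record
    { +-isCommutativeMonoid = record
      { isMonoid = record
        { isSemigroup = record
          { isMagma = record { isEquivalence = ≈-isEquivalence ; ∙-cong = ⊕-cong }
          ; assoc = λ f g h → ≐⇒≈ (⊕-assoc f g h) }
        ; identity = (λ f → ≐⇒≈ (⊕-identityˡ f)) , (λ f → ≐⇒≈ (⊕-identityʳ f)) }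
      ; comm = λ f g → ≐⇒≈ (⊕-comm f g) }
    ; *-isCommutativeMonoid = record
      { isMonoid = record
        { isSemigroup = record
          { isMagma = record { isEquivalence = ≈-isEquivalence ; ∙-cong = ⊛-cong }
          ; assoc = λ f g h → ≐⇒≈ (⊛-assoc f g h) }
        ; identity = (λ f → ≐⇒≈ (⊛-identityˡ f))
                   , (λ f → ≐⇒≈ (λ i → trans (⊛-comm f 𝟙 i) (⊛-identityˡ f i))) }
      ; comm = λ f g → ≐⇒≈ (⊛-comm f g) }
    ; distribʳ = λ f g h → ≐⇒≈ (⊛-distribʳ f g h)
    ; zeroˡ    = λ f → ≐⇒≈ (⊛-zeroˡ f)
    }

  ℤ[Cₑ]/p : CommutativeSemiring 0ℓ 0ℓ
  ℤ[Cₑ]/p = record { isCommutativeSemiring = ℤ[Cₑ]/p-isCommutativeSemiring }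

  open CommutativeSemiring ℤ[Cₑ]/p using (semiring; +-monoid)
  open import Algebra.Properties.Semiring.Exp semiring
    using (^-congˡ; ^-congʳ; ^-homo-*; ^-assocʳ) renaming (_^_ to _^ᴿ_)
  open import Algebra.Properties.Monoid.Mult +-monoid using () renaming (_×_ to _×ᴹ_)
  module ≈-Reasoning = SetoidReasoning (CommutativeSemiring.setoid ℤ[Cₑ]/p)

  infix 4 _≡ₑ_
  record _≡ₑ_ (x y : ℕ) : Set where
    constructor mod-e
    field %-≡ : x % e ≡ y % e
  open _≡ₑ_ public

  ≡ₑ-trans : ∀ {x y z} → x ≡ₑ y → y ≡ₑ z → x ≡ₑ z
  ≡ₑ-trans (mod-e h) (mod-e k) = mod-e (trans h k)

  ≡ₑ-sym : ∀ {x y} → x ≡ₑ y → y ≡ₑ x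
  ≡ₑ-sym (mod-e h) = mod-e (sym h)

  ≡⇒≡ₑ : ∀ {x y} → x ≡ y → x ≡ₑ y
  ≡⇒≡ₑ eq = mod-e (cong (_% e) eq)

  ≡ₑ-+ʳ : ∀ {x y} z → x ≡ₑ y → x ℕ.+ z ≡ₑ y ℕ.+ z
  ≡ₑ-+ʳ {x} {y} z (mod-e h) = mod-e (trans (ℕD.%-distribˡ-+ x z e)
    (trans (cong (λ w → (w ℕ.+ z % e) % e) h) (sym (ℕD.%-distribˡ-+ y z e))))

  ≡ₑ-*ˡ : ∀ {x y} z → x ≡ₑ y → z ℕ.* x ≡ₑ z ℕ.* y
  ≡ₑ-*ˡ {x} {y} z (mod-e h) = mod-e (trans (ℕD.%-distribˡ-* z x e)
    (trans (cong (λ w → (z % e ℕ.* w) % e) h) (sym (ℕD.%-distribˡ-* z y e))))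

  +*e≡ₑ : ∀ x k → x ℕ.+ k ℕ.* e ≡ₑ x
  +*e≡ₑ x k = mod-e (ℕD.[m+kn]%n≡m%n x k e)

  %≡ₑ : ∀ x → x % e ≡ₑ x
  %≡ₑ x = mod-e (ℕD.m%n%n≡m%n x e)

  d*[d*x]≡ₑx : ∀ x → d ℕ.* (d ℕ.* x) ≡ₑ x
  d*[d*x]≡ₑx x =
    ≡ₑ-trans (≡ₑ-sym (+*e≡ₑ _ x)) (≡ₑ-trans (≡⇒≡ₑ (expand d x)) (+*e≡ₑ x (d ℕ.* x)))
    where
    expand : ∀ d x → d ℕ.* (d ℕ.* x) ℕ.+ x ℕ.* suc d ≡ x ℕ.+ (d ℕ.* x) ℕ.* suc d
    expand = ℕSolver.solve-∀

  x≡ₑd⇒x*x≡ₑ1 : ∀ {x} → x ≡ₑ d → x ℕ.* x ≡ₑ 1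
  x≡ₑd⇒x*x≡ₑ1 {x} x≡d = ≡ₑ-trans (≡ₑ-*ˡ x x≡d) (≡ₑ-trans (≡⇒≡ₑ (ℕP.*-comm x d))
    (≡ₑ-trans (≡ₑ-*ˡ d x≡d)
      (≡ₑ-trans (≡⇒≡ₑ (cong (d ℕ.*_) (sym (ℕP.*-identityʳ d)))) (d*[d*x]≡ₑx 1))))

  e∣1+x⇒x≡ₑd : ∀ x → e ∣ x ℕ.+ 1 → x ≡ₑ d
  e∣1+x⇒x≡ₑd x e∣x+1 = ≡ₑ-trans (≡ₑ-sym (≡ₑ-trans (≡⇒≡ₑ (shuffle x d)) (+*e≡ₑ x 1)))
    (≡ₑ-+ʳ d (mod-e (ℕDiv.n∣m⇒m%n≡0 _ e e∣x+1)))
    where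
    shuffle : ∀ x d → x ℕ.+ 1 ℕ.+ d ≡ x ℕ.+ 1 ℕ.* suc d
    shuffle = ℕSolver.solve-∀

  sumᶜ : ℕ → (ℕ → Cyclic e) → Cyclic e
  sumᶜ zero    u = 𝟘
  sumᶜ (suc n) u = sumᶜ n u ⊕ u n

  at-sumᶜ : ∀ n u i → at (sumᶜ n u) i ≡ sumTo n (λ k → at (u k) i)
  at-sumᶜ zero    u i = refl
  at-sumᶜ (suc n) u i = cong (_+ at (u n) i) (at-sumᶜ n u i)

  sumᶜ-cong : ∀ n {u v} → (∀ k → u k ≈ v k) → sumᶜ n u ≈ sumᶜ n v
  sumᶜ-cong zero    h = ≐⇒≈ (λ _ → refl)
  sumᶜ-cong (suc n) h = ⊕-cong (sumᶜ-cong n h) (h n)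

  monomial-⊛ : ∀ a b c c′ → monomial a c ⊛ monomial b c′ ≐ monomial (a ℕ.+ b) (c * c′)
  monomial-⊛ a b c c′ s = begin
    sumTo e (λ i → monomialAt a c i * monomialAt b c′ (s ℕ.+ d ℕ.* i))
      ≡⟨ sumTo-single e _ a′ (ℕD.m%n<n a e) off-a ⟩
    monomialAt a c a′ * monomialAt b c′ (s ℕ.+ d ℕ.* a′)
      ≡⟨ cong (_* monomialAt b c′ (s ℕ.+ d ℕ.* a′)) (monomialAt-≡ a c a′ (ℕD.m%n%n≡m%n a e)) ⟩
    c * monomialAt b c′ (s ℕ.+ d ℕ.* a′)
      ≡⟨ at-a ⟩
    monomialAt (a ℕ.+ b) (c * c′) s ∎
    where
    open ≡-Reasoning
    a′ : ℕ
    a′ = a % e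
    off-a : ∀ i → i < e → ¬ i ≡ a′ → monomialAt a c i * monomialAt b c′ (s ℕ.+ d ℕ.* i) ≡ 0ℤ
    off-a i i<e i≢a′ = cong (_* monomialAt b c′ (s ℕ.+ d ℕ.* i))
      (monomialAt-≢ a c i (λ eq → i≢a′ (trans (sym (ℕD.m<n⇒m%n≡m i<e)) eq)))
    expand₁ : ∀ d a′ b → a′ ℕ.+ b ℕ.+ d ℕ.* a′ ≡ b ℕ.+ a′ ℕ.* suc d
    expand₁ = ℕSolver.solve-∀
    expand₂ : ∀ d s a′ → s ℕ.+ d ℕ.* a′ ℕ.+ a′ ≡ s ℕ.+ a′ ℕ.* suc d
    expand₂ = ℕSolver.solve-∀
    shifted⇐ : s ≡ₑ a ℕ.+ b → s ℕ.+ d ℕ.* a′ ≡ₑ b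
    shifted⇐ h = ≡ₑ-trans (≡ₑ-+ʳ (d ℕ.* a′) (≡ₑ-trans h (≡ₑ-+ʳ b (≡ₑ-sym (%≡ₑ a)))))
                          (≡ₑ-trans (≡⇒≡ₑ (expand₁ d a′ b)) (+*e≡ₑ b a′))
    shifted⇒ : s ℕ.+ d ℕ.* a′ ≡ₑ b → s ≡ₑ a ℕ.+ b
    shifted⇒ h = ≡ₑ-trans (≡ₑ-sym (+*e≡ₑ s a′)) (≡ₑ-trans (≡⇒≡ₑ (sym (expand₂ d s a′)))
                   (≡ₑ-trans (≡ₑ-+ʳ a′ h)
                     (≡ₑ-trans (≡⇒≡ₑ (ℕP.+-comm b a′)) (≡ₑ-+ʳ b (%≡ₑ a)))))
    at-a : c * monomialAt b c′ (s ℕ.+ d ℕ.* a′) ≡ monomialAt (a ℕ.+ b) (c * c′) s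
    at-a with s % e ℕP.≟ (a ℕ.+ b) % e
    ... | yes h = trans (cong (c *_) (monomialAt-≡ b c′ (s ℕ.+ d ℕ.* a′) (%-≡ (shifted⇐ (mod-e h)))))
                        (sym (monomialAt-≡ (a ℕ.+ b) (c * c′) s h))
    ... | no h  = trans (cong (c *_) (monomialAt-≢ b c′ (s ℕ.+ d ℕ.* a′)
                                       (λ eq → h (%-≡ (shifted⇒ (mod-e eq))))))
                        (trans (ℤP.*-zeroʳ c) (sym (monomialAt-≢ (a ℕ.+ b) (c * c′) s h)))

  monomial-^ : ∀ q a c → monomial a c ^ᴿ q ≈ monomial (q ℕ.* a) (c ^ q)
  monomial-^ zero    a c = ≈-refl
  monomial-^ (suc q) a c = begin
    monomial a c ⊛ monomial a c ^ᴿ q                ≈⟨ ⊛-congˡ (monomial a c) (monomial-^ q a c) ⟩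
    monomial a c ⊛ monomial (q ℕ.* a) (c ^ q)       ≈⟨ ≐⇒≈ (monomial-⊛ a (q ℕ.* a) c (c ^ q)) ⟩
    monomial (suc q ℕ.* a) (c ^ suc q)              ∎
    where open ≈-Reasoning

  monomial-≡ₚ : ∀ a {c c′} → c ≡ₚ c′ → monomial a c ≈ monomial a c′
  monomial-≡ₚ a h = pointwise λ i → coefficient i
    where
    coefficient : ∀ i → monomialAt a _ i ≡ₚ monomialAt a _ i
    coefficient i with i % e ℕ.≡ᵇ a % e
    ... | true  = h
    ... | false = ≡⇒≡ₚ refl

  monomial-≡ₑ : ∀ {a b} c → a ≡ₑ b → monomial a c ≐ monomial b c
  monomial-≡ₑ c (mod-e h) i = cong (λ r → if i % e ℕ.≡ᵇ r then c else 0ℤ) h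

  -- Σᵢ cᵢ x^(q·i): the substitution x ↦ x^q applied to Σᵢ cᵢ xⁱ.
  dilate : ℕ → (ℕ → ℤ) → Cyclic e
  dilate q c = sumᶜ e (λ i → monomial (q ℕ.* i) (c i))

  dilate-1 : ∀ f → f ≐ dilate 1 (at f)
  dilate-1 f s = sym (begin
    at (dilate 1 (at f)) s                           ≡⟨ at-sumᶜ e _ s ⟩
    sumTo e (λ i → monomialAt (1 ℕ.* i) (at f i) s)  ≡⟨ sumTo-single e _ (s % e) (ℕD.m%n<n s e) off-s ⟩
    monomialAt (1 ℕ.* (s % e)) (at f (s % e)) s      ≡⟨ monomialAt-≡ (1 ℕ.* (s % e)) (at f (s % e)) s on-s ⟩
    at f (s % e)                                     ≡⟨ periodic-% (periodic f) s ⟩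
    at f s                                           ∎)
    where
    open ≡-Reasoning
    on-s : s % e ≡ (1 ℕ.* (s % e)) % e
    on-s = sym (%-≡ (≡ₑ-trans (≡⇒≡ₑ (ℕP.*-identityˡ _)) (%≡ₑ s)))
    off-s : ∀ i → i < e → ¬ i ≡ s % e → monomialAt (1 ℕ.* i) (at f i) s ≡ 0ℤ
    off-s i i<e i≢s = monomialAt-≢ (1 ℕ.* i) (at f i) s (λ eq → i≢s (sym (trans eq
      (trans (cong (_% e) (ℕP.*-identityˡ i)) (ℕD.m<n⇒m%n≡m i<e)))))

  dilate-≡ₑ : ∀ {q q′} c → q ≡ₑ q′ → dilate q c ≈ dilate q′ c
  dilate-≡ₑ {q} {q′} c q≡q′ = sumᶜ-cong e (λ i → ≐⇒≈ (monomial-≡ₑ (c i)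
    (≡ₑ-trans (≡⇒≡ₑ (ℕP.*-comm q i))
      (≡ₑ-trans (≡ₑ-*ˡ i q≡q′) (≡⇒≡ₑ (ℕP.*-comm i q′))))))

  at-dilate-d : ∀ f t → at (dilate d (at f)) t ≡ at f (d ℕ.* t)
  at-dilate-d f t = begin
    at (dilate d (at f)) t                           ≡⟨ at-sumᶜ e _ t ⟩
    sumTo e (λ k → monomialAt (d ℕ.* k) (at f k) t)  ≡⟨ sumTo-single e _ k₀ (ℕD.m%n<n (d ℕ.* t) e) off-k₀ ⟩
    monomialAt (d ℕ.* k₀) (at f k₀) t                ≡⟨ monomialAt-≡ (d ℕ.* k₀) (at f k₀) t on-k₀ ⟩
    at f k₀                                          ≡⟨ periodic-% (periodic f) (d ℕ.* t) ⟩
    at f (d ℕ.* t)                                   ∎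
    where
    open ≡-Reasoning
    k₀ : ℕ
    k₀ = (d ℕ.* t) % e
    on-k₀ : t % e ≡ (d ℕ.* k₀) % e
    on-k₀ = %-≡ (≡ₑ-sym (≡ₑ-trans (≡ₑ-*ˡ d (%≡ₑ (d ℕ.* t))) (d*[d*x]≡ₑx t)))
    off-k₀ : ∀ k → k < e → ¬ k ≡ k₀ → monomialAt (d ℕ.* k) (at f k) t ≡ 0ℤ
    off-k₀ k k<e k≢k₀ = monomialAt-≢ (d ℕ.* k) (at f k) t (λ eq → k≢k₀ (sym
      (trans (%-≡ (≡ₑ-trans (≡ₑ-*ˡ d (mod-e eq)) (d*[d*x]≡ₑx k))) (ℕD.m<n⇒m%n≡m k<e))))

  at-⊛-dilate-d : ∀ f s → at (f ⊛ dilate d (at f)) s ≡ correlation e (at f) (d ℕ.* s)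
  at-⊛-dilate-d f s = sumTo-ext e (λ i → cong (at f i *_)
    (trans (at-dilate-d f (s ℕ.+ d ℕ.* i)) (periodic-≡ (periodic f) _ _ i (d ℕ.* i) (reflect d s i))))
    where
    reflect : ∀ d s i →
      d ℕ.* (s ℕ.+ d ℕ.* i) ℕ.+ i ℕ.* suc d ≡ i ℕ.+ d ℕ.* s ℕ.+ (d ℕ.* i) ℕ.* suc d
    reflect = ℕSolver.solve-∀

  module _ (prime : Prime p) where

    open Fermat prime using (fermat; characteristic)
    open import Algebra.Properties.Monoid.Mult (CommutativeSemiring.+-monoid ℤ/p)
      using () renaming (_×_ to _×ℤ_)

    characteristicᶜ : ∀ f → p ×ᴹ f ≈ 𝟘
    characteristicᶜ f = pointwise (λ i → subst (_≡ₚ 0ℤ) (sym (at-× p i)) (characteristic (at f i)))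
      where
      at-× : ∀ n i → at (n ×ᴹ f) i ≡ n ×ℤ at f i
      at-× zero    i = refl
      at-× (suc n) i = cong (λ z → at f i + z) (at-× n i)

    frobeniusᶜ : ∀ f g → (f ⊕ g) ^ᴿ p ≈ f ^ᴿ p ⊕ g ^ᴿ p
    frobeniusᶜ = Frobenius.frobenius ℤ[Cₑ]/p prime characteristicᶜ

    𝟘^p≈𝟘 : 𝟘 ^ᴿ p ≈ 𝟘
    𝟘^p≈𝟘 =
      subst (λ m → 𝟘 ^ᴿ m ≈ 𝟘) (ℕP.m+[n∸m]≡n 1≤p) (≐⇒≈ (⊛-zeroˡ (𝟘 ^ᴿ (p ∸ 1))))
      where
      1≤p : 1 ≤ p
      1≤p = ℕP.<⇒≤ (ℕ.nonTrivial⇒n>1 p {{prime⇒nonTrivial prime}})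

    frobenius-sumᶜ : ∀ n u → sumᶜ n u ^ᴿ p ≈ sumᶜ n (λ k → u k ^ᴿ p)
    frobenius-sumᶜ zero    u = 𝟘^p≈𝟘
    frobenius-sumᶜ (suc n) u = begin
      (sumᶜ n u ⊕ u n) ^ᴿ p           ≈⟨ frobeniusᶜ (sumᶜ n u) (u n) ⟩
      sumᶜ n u ^ᴿ p ⊕ u n ^ᴿ p         ≈⟨ ⊕-congʳ (u n ^ᴿ p) (frobenius-sumᶜ n u) ⟩
      sumᶜ n (λ k → u k ^ᴿ p) ⊕ u n ^ᴿ p ∎
      where open ≈-Reasoning

    dilate-^p : ∀ q c → dilate q c ^ᴿ p ≈ dilate (p ℕ.* q) c
    dilate-^p q c = begin
      dilate q c ^ᴿ p                                   ≈⟨ frobenius-sumᶜ e _ ⟩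
      sumᶜ e (λ i → monomial (q ℕ.* i) (c i) ^ᴿ p)      ≈⟨ sumᶜ-cong e term ⟩
      dilate (p ℕ.* q) c                                ∎
      where
      open ≈-Reasoning
      term : ∀ i → monomial (q ℕ.* i) (c i) ^ᴿ p ≈ monomial (p ℕ.* q ℕ.* i) (c i)
      term i = begin
        monomial (q ℕ.* i) (c i) ^ᴿ p         ≈⟨ monomial-^ p (q ℕ.* i) (c i) ⟩
        monomial (p ℕ.* (q ℕ.* i)) (c i ^ p)  ≈⟨ monomial-≡ₚ (p ℕ.* (q ℕ.* i)) (fermat (c i)) ⟩
        monomial (p ℕ.* (q ℕ.* i)) (c i)
          ≈⟨ ≐⇒≈ (monomial-≡ₑ (c i) (≡⇒≡ₑ (sym (ℕP.*-assoc p q i)))) ⟩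
        monomial (p ℕ.* q ℕ.* i) (c i)        ∎

    ^p^m≈dilate : ∀ f m → f ^ᴿ (p ℕ.^ m) ≈ dilate (p ℕ.^ m) (at f)
    ^p^m≈dilate f zero    = ≐⇒≈ (λ i → trans (⊛-comm f 𝟙 i) (trans (⊛-identityˡ f i) (dilate-1 f i)))
    ^p^m≈dilate f (suc m) = begin
      f ^ᴿ (p ℕ.* p ℕ.^ m)                  ≈⟨ ^-congʳ f (ℕP.*-comm p (p ℕ.^ m)) ⟩
      f ^ᴿ (p ℕ.^ m ℕ.* p)                  ≈⟨ ^-assocʳ f (p ℕ.^ m) p ⟨
      (f ^ᴿ (p ℕ.^ m)) ^ᴿ p                 ≈⟨ ^-congˡ p (^p^m≈dilate f m) ⟩
      dilate (p ℕ.^ m) (at f) ^ᴿ p          ≈⟨ dilate-^p (p ℕ.^ m) (at f) ⟩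
      dilate (p ℕ.* p ℕ.^ m) (at f)         ∎
      where open ≈-Reasoning

    -- With q = p^(c+1) ≡ -1: f ⊛ f^q ≈ f ⊛ f(x⁻¹) is the correlation, hence ≈ 0,
    -- while q² ≡ 1 gives f ≈ f^(q²) = (f ⊛ f^q) ⊛ f^(q² - q - 1).
    correlations-divisible⇒divisible : ∀ c → p ℕ.^ suc c ≡ₑ d → ∀ f →
      (∀ t → + p ∣ₛ correlation e (at f) t) → ∀ i → + p ∣ₛ at f i
    correlations-divisible⇒divisible c q≡d f p∣correlation i =
      subst (+ p ∣ₛ_) (ℤP.+-identityʳ (at f i)) (p∣x-y (at-≡ₚ f≈𝟘 i))
      where
      open ≈-Reasoning
      q : ℕ
      q = p ℕ.^ suc c
      2≤q : 2 ≤ q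
      2≤q = ℕP.≤-trans (ℕ.nonTrivial⇒n>1 p {{prime⇒nonTrivial prime}})
        (ℕP.m≤m*n p (p ℕ.^ c) {{ℕP.m^n≢0 p c {{ℕ.nonTrivial⇒nonZero p {{prime⇒nonTrivial prime}}}}}})
      1+q≤q*q : suc q ≤ q ℕ.* q
      1+q≤q*q = ℕP.≤-trans (ℕP.+-monoˡ-≤ q (ℕP.<⇒≤ 2≤q))
        (ℕP.≤-trans (ℕP.≤-reflexive (cong (q ℕ.+_) (sym (ℕP.+-identityʳ q)))) (ℕP.*-monoˡ-≤ q 2≤q))
      r : ℕ
      r = q ℕ.* q ∸ suc q
      q*q≡1+q+r : q ℕ.* q ≡ suc q ℕ.+ r
      q*q≡1+q+r = sym (ℕP.m+[n∸m]≡n 1+q≤q*q)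
      f^[q*q]≈dilate : f ^ᴿ (q ℕ.* q) ≈ dilate (q ℕ.* q) (at f)
      f^[q*q]≈dilate = subst (λ k → f ^ᴿ k ≈ dilate k (at f)) (ℕP.^-distribˡ-+-* p (suc c) (suc c))
                             (^p^m≈dilate f (suc c ℕ.+ suc c))
      f⊛f[x⁻¹]≈𝟘 : f ⊛ dilate d (at f) ≈ 𝟘
      f⊛f[x⁻¹]≈𝟘 = pointwise λ s → mod-p (subst (+ p ∣ₛ_)
        (sym (trans (cong (_- 0ℤ) (at-⊛-dilate-d f s)) (ℤP.+-identityʳ _))) (p∣correlation (d ℕ.* s)))
      f≈𝟘 : f ≈ 𝟘
      f≈𝟘 = begin
        f                                ≈⟨ ≐⇒≈ (dilate-1 f) ⟩
        dilate 1 (at f)                  ≈⟨ dilate-≡ₑ (at f) (x≡ₑd⇒x*x≡ₑ1 q≡d) ⟨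
        dilate (q ℕ.* q) (at f)          ≈⟨ f^[q*q]≈dilate ⟨
        f ^ᴿ (q ℕ.* q)                   ≈⟨ ^-congʳ f q*q≡1+q+r ⟩
        f ^ᴿ (suc q ℕ.+ r)               ≈⟨ ^-homo-* f (suc q) r ⟩
        (f ⊛ f ^ᴿ q) ⊛ f ^ᴿ r            ≈⟨ ⊛-congʳ (f ^ᴿ r) (⊛-congˡ f (^p^m≈dilate f (suc c))) ⟩
        (f ⊛ dilate q (at f)) ⊛ f ^ᴿ r   ≈⟨ ⊛-congʳ (f ^ᴿ r) (⊛-congˡ f (dilate-≡ₑ (at f) q≡d)) ⟩
        (f ⊛ dilate d (at f)) ⊛ f ^ᴿ r   ≈⟨ ⊛-congʳ (f ^ᴿ r) f⊛f[x⁻¹]≈𝟘 ⟩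
        𝟘 ⊛ f ^ᴿ r                       ≈⟨ ≐⇒≈ (⊛-zeroˡ (f ^ᴿ r)) ⟩
        𝟘                                ∎

module OddValuation where

  OddValAt : ℕ → ℕ → ℕ → Set
  OddValAt p k x = k % 2 ≡ 1 × p ℕ.^ k ∣ x × ¬ p ℕ.^ suc k ∣ x

  OddValℕ : ℕ → ℕ → Set
  OddValℕ p x = ∃ λ k → OddValAt p k x

  2+k-odd : ∀ k → (2 ℕ.+ k) % 2 ≡ k % 2
  2+k-odd k = trans (cong (_% 2) (ℕP.+-comm 2 k)) (ℕD.[m+n]%n≡m%n k 2)

  module _ {p : ℕ} (prime : Prime p) where

    private instance
      p≢0 : ℕ.NonZero p
      p≢0 = ℕ.nonTrivial⇒nonZero p {{prime⇒nonTrivial prime}}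

    p²≢0 : ℕ.NonZero (p ℕ.* p)
    p²≢0 = ℕP.m*n≢0 p p

    p^[2+k]≡p²*p^k : ∀ k → p ℕ.^ (2 ℕ.+ k) ≡ (p ℕ.* p) ℕ.* p ℕ.^ k
    p^[2+k]≡p²*p^k k = sym (ℕP.*-assoc p p (p ℕ.^ k))

    p^k∣x*y⇒p^k∣x : ∀ k x y → p ℕ.^ k ∣ x ℕ.* y → ¬ p ∣ y → p ℕ.^ k ∣ x
    p^k∣x*y⇒p^k∣x zero    x y _ _ = ℕDiv.1∣ x
    p^k∣x*y⇒p^k∣x (suc k) x y pᵏ⁺¹∣xy p∤y
      with p^k∣x*y⇒p^k∣x k x y (ℕDiv.∣-trans (ℕDiv.n∣m*n p) pᵏ⁺¹∣xy) p∤y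
    ... | ℕDiv.divides x′ refl = ℕDiv.*-monoˡ-∣ (p ℕ.^ k) p∣x′
      where
      regroup : p ℕ.^ k ℕ.* p ∣ p ℕ.^ k ℕ.* (x′ ℕ.* y)
      regroup = subst₂ _∣_ (ℕP.*-comm p (p ℕ.^ k))
        (trans (ℕP.*-assoc x′ (p ℕ.^ k) y) (trans (cong (x′ ℕ.*_) (ℕP.*-comm (p ℕ.^ k) y))
          (trans (sym (ℕP.*-assoc x′ y (p ℕ.^ k))) (ℕP.*-comm (x′ ℕ.* y) (p ℕ.^ k)))))
        pᵏ⁺¹∣xy
      p∣x′ : p ∣ x′
      p∣x′ with euclidsLemma x′ y prime (ℕDiv.*-cancelˡ-∣ (p ℕ.^ k) {{ℕP.m^n≢0 p k}} regroup)
      ... | inj₁ p∣x′ = p∣x′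
      ... | inj₂ p∣y  = ⊥-elim (p∤y p∣y)

    oddValAt⇒∣ : ∀ {k x} → OddValAt p (suc k) x → p ∣ x
    oddValAt⇒∣ {k} (_ , pᵏ⁺¹∣x , _) = ℕDiv.∣-trans (ℕDiv.m∣m*n (p ℕ.^ k)) pᵏ⁺¹∣x

    oddVal⇒∣ : ∀ {x} → OddValℕ p x → p ∣ x
    oddVal⇒∣ (zero  , () , _)
    oddVal⇒∣ (suc k , v) = oddValAt⇒∣ {k} v

    oddVal-*ʳ : ∀ x y → OddValℕ p x → ¬ p ∣ y → OddValℕ p (x ℕ.* y)
    oddVal-*ʳ x y (k , odd , pᵏ∣x , pᵏ⁺¹∤x) p∤y =
      k , odd , ℕDiv.∣m⇒∣m*n y pᵏ∣x , (λ h → pᵏ⁺¹∤x (p^k∣x*y⇒p^k∣x (suc k) x y h p∤y))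

    oddVal-*ˡ : ∀ x y → ¬ p ∣ x → OddValℕ p y → OddValℕ p (x ℕ.* y)
    oddVal-*ˡ x y p∤x h = subst (OddValℕ p) (ℕP.*-comm y x) (oddVal-*ʳ y x h p∤x)

    oddVal-*ʳ⁻¹ : ∀ x y → OddValℕ p (x ℕ.* y) → ¬ p ∣ y → OddValℕ p x
    oddVal-*ʳ⁻¹ x y (k , odd , pᵏ∣xy , pᵏ⁺¹∤xy) p∤y =
      k , odd , p^k∣x*y⇒p^k∣x k x y pᵏ∣xy p∤y , (λ h → pᵏ⁺¹∤xy (ℕDiv.∣m⇒∣m*n y h))

    oddVal-p²* : ∀ x → OddValℕ p x → OddValℕ p ((p ℕ.* p) ℕ.* x)
    oddVal-p²* x (k , odd , pᵏ∣x , pᵏ⁺¹∤x) =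
      2 ℕ.+ k , trans (2+k-odd k) odd ,
      subst (_∣ (p ℕ.* p) ℕ.* x) (sym (p^[2+k]≡p²*p^k k)) (ℕDiv.*-monoʳ-∣ (p ℕ.* p) pᵏ∣x) ,
      (λ h → pᵏ⁺¹∤x (ℕDiv.*-cancelˡ-∣ (p ℕ.* p) {{p²≢0}}
                      (subst (_∣ (p ℕ.* p) ℕ.* x) (p^[2+k]≡p²*p^k (suc k)) h)))

    ¬oddValAt-1-p²* : ∀ x → ¬ OddValAt p 1 ((p ℕ.* p) ℕ.* x)
    ¬oddValAt-1-p²* x (_ , _ , p²∤p²x) =
      p²∤p²x (subst (_∣ (p ℕ.* p) ℕ.* x) (cong (p ℕ.*_) (sym (ℕP.*-identityʳ p))) (ℕDiv.m∣m*n x))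

    oddValAt-p²*⁻¹ : ∀ k x → OddValAt p (2 ℕ.+ k) ((p ℕ.* p) ℕ.* x) → OddValAt p k x
    oddValAt-p²*⁻¹ k x (odd , pᵏ⁺²∣ , pᵏ⁺³∤) =
      trans (sym (2+k-odd k)) odd ,
      ℕDiv.*-cancelˡ-∣ (p ℕ.* p) {{p²≢0}} (subst (_∣ (p ℕ.* p) ℕ.* x) (p^[2+k]≡p²*p^k k) pᵏ⁺²∣) ,
      (λ h → pᵏ⁺³∤ (subst (_∣ (p ℕ.* p) ℕ.* x) (sym (p^[2+k]≡p²*p^k (suc k)))
                          (ℕDiv.*-monoʳ-∣ (p ℕ.* p) h)))

    oddVal-p²*⁻¹ : ∀ x → OddValℕ p ((p ℕ.* p) ℕ.* x) → OddValℕ p x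
    oddVal-p²*⁻¹ x (zero , () , _)
    oddVal-p²*⁻¹ x (suc zero , v) = ⊥-elim (¬oddValAt-1-p²* x v)
    oddVal-p²*⁻¹ x (suc (suc k) , v) = k , oddValAt-p²*⁻¹ k x v

    oddVal-*-coprime : ∀ x y → (p ∣ x → p ∣ y → ⊥) →
      OddValℕ p x ⊎ OddValℕ p y → OddValℕ p (x ℕ.* y)
    oddVal-*-coprime x y coprime (inj₁ v) = oddVal-*ʳ x y v (coprime (oddVal⇒∣ v))
    oddVal-*-coprime x y coprime (inj₂ v) = oddVal-*ˡ x y (λ p∣x → coprime p∣x (oddVal⇒∣ v)) v

    oddVal-*ˡ⁻¹ : ∀ x y → ¬ p ∣ x → OddValℕ p (x ℕ.* y) → OddValℕ p y
    oddVal-*ˡ⁻¹ x y p∤x v = oddVal-*ʳ⁻¹ y x (subst (OddValℕ p) (ℕP.*-comm x y) v) p∤x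

open OddValuation

module Descent (d p : ℕ) (prime : Prime p) where

  open import Data.Integer using (_*_; ∣_∣)
  open GroupRing d p

  private instance
    p≢0 : ℕ.NonZero p
    p≢0 = ℕ.nonTrivial⇒nonZero p {{prime⇒nonTrivial prime}}

  cancel-p² : ∀ x y → x * (+ p * + p) ≡ y * (+ p * + p) → x ≡ y
  cancel-p² x y = ℤP.*-cancelʳ-≡ x y (+ p * + p) {{ℤP.i*j≢0 (+ p) (+ p)}}

  module _ (1≤d : 1 ≤ d) (c : ℕ) (q≡d : p ℕ.^ suc c ≡ₑ d) where

    twoLevel⇒p∣ : ∀ (f : Cyclic e) M → TwoLevel d (at f) M → p ∣ ∣ M ∣ → ∀ i → + p ∣ₛ at f i
    twoLevel⇒p∣ f M (two₀ , two₁) p∣M = correlations-divisible⇒divisible prime c q≡d f p∣correlation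
      where
      p∣ₛM : + p ∣ₛ M
      p∣ₛM = ℤD.∣ᵤ⇒∣ p∣M
      p∣correlation< : ∀ s → s < e → + p ∣ₛ correlation e (at f) s
      p∣correlation< zero    _   = subst (+ p ∣ₛ_) (sym two₀) (ℤD.∣m⇒∣m*n (+ d) p∣ₛM)
      p∣correlation< (suc s) s<e =
        subst (+ p ∣ₛ_) (sym (two₁ (suc s) (s≤s z≤n) s<e)) (ℤD.∣m⇒∣-m p∣ₛM)
      p∣correlation : ∀ t → + p ∣ₛ correlation e (at f) t
      p∣correlation t = subst (+ p ∣ₛ_) (periodic-% (correlation-periodic e (periodic f)) t)
                              (p∣correlation< (t % e) (ℕD.m%n<n t e))

    twoLevel-÷p : ∀ (f g : Cyclic e) M → (∀ i → at f i ≡ at g i * + p) → TwoLevel d (at f) M →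
      Σ ℤ λ M′ → TwoLevel d (at g) M′ × ∣ M ∣ ≡ (p ℕ.* p) ℕ.* ∣ M′ ∣
    twoLevel-÷p f g M f≡g*p (two₀ , two₁) = M′ , (two₀′ , two₁′) , ∣M∣≡p²∣M′∣
      where
      scale : ∀ s → correlation e (at f) s ≡ correlation e (at g) s * (+ p * + p)
      scale = correlation-scale e {at f} {at g} (+ p) f≡g*p
      M′ : ℤ
      M′ = - correlation e (at g) 1
      M≡M′*p² : M ≡ M′ * (+ p * + p)
      M≡M′*p² = begin
        M                                        ≡⟨ ℤP.neg-involutive M ⟨
        - - M                                    ≡⟨ cong -_ (two₁ 1 ℕP.≤-refl (s≤s 1≤d)) ⟨
        - correlation e (at f) 1                 ≡⟨ cong -_ (scale 1) ⟩
        - (correlation e (at g) 1 * (+ p * + p)) ≡⟨ ℤP.neg-distribˡ-* (correlation e (at g) 1) (+ p * + p) ⟩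
        M′ * (+ p * + p)                         ∎
        where open ≡-Reasoning
      ∣M∣≡p²∣M′∣ : ∣ M ∣ ≡ (p ℕ.* p) ℕ.* ∣ M′ ∣
      ∣M∣≡p²∣M′∣ = trans (cong ∣_∣ M≡M′*p²) (trans (ℤP.abs-* M′ (+ p * + p))
        (trans (cong (∣ M′ ∣ ℕ.*_) (ℤP.abs-* (+ p) (+ p))) (ℕP.*-comm ∣ M′ ∣ (p ℕ.* p))))
      two₀′ : correlation e (at g) 0 ≡ M′ * + d
      two₀′ = cancel-p² (correlation e (at g) 0) (M′ * + d) (begin
        correlation e (at g) 0 * (+ p * + p)   ≡⟨ scale 0 ⟨
        correlation e (at f) 0                 ≡⟨ two₀ ⟩
        M * + d                                ≡⟨ cong (_* + d) M≡M′*p² ⟩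
        M′ * (+ p * + p) * + d                 ≡⟨ swap M′ (+ p * + p) (+ d) ⟩
        M′ * + d * (+ p * + p)                 ∎)
        where
        open ≡-Reasoning
        swap : ∀ a b c → (a * b) * c ≡ (a * c) * b
        swap = solve-∀
      two₁′ : ∀ s → 1 ≤ s → s < e → correlation e (at g) s ≡ - M′
      two₁′ s 1≤s s<e = cancel-p² (correlation e (at g) s) (- M′) (begin
        correlation e (at g) s * (+ p * + p)   ≡⟨ scale s ⟨
        correlation e (at f) s                 ≡⟨ two₁ s 1≤s s<e ⟩
        - M                                    ≡⟨ cong -_ M≡M′*p² ⟩
        - (M′ * (+ p * + p))                   ≡⟨ ℤP.neg-distribˡ-* M′ (+ p * + p) ⟩
        - M′ * (+ p * + p)                     ∎)
        where open ≡-Reasoning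

    divide-by-p : ∀ (f : Cyclic e) M → TwoLevel d (at f) M → p ∣ ∣ M ∣ →
      Σ (Cyclic e) λ g → Σ ℤ λ M′ → TwoLevel d (at g) M′ × ∣ M ∣ ≡ (p ℕ.* p) ℕ.* ∣ M′ ∣
    divide-by-p f M two p∣M =
      let g , f≡g*p = divide-cyclic (+ p) f (twoLevel⇒p∣ f M two p∣M)
      in  g , twoLevel-÷p f g M f≡g*p two

    twoLevel⇒¬oddValAt : ∀ k (f : Cyclic e) M → TwoLevel d (at f) M → ¬ OddValAt p k ∣ M ∣
    twoLevel⇒¬oddValAt zero f M two (() , _)
    twoLevel⇒¬oddValAt (suc zero) f M two v =
      let _ , M′ , _ , ∣M∣≡p²∣M′∣ = divide-by-p f M two (oddValAt⇒∣ prime {0} v)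
      in  ¬oddValAt-1-p²* prime ∣ M′ ∣ (subst (OddValAt p 1) ∣M∣≡p²∣M′∣ v)
    twoLevel⇒¬oddValAt (suc (suc k)) f M two v =
      let g , M′ , two′ , ∣M∣≡p²∣M′∣ = divide-by-p f M two (oddValAt⇒∣ prime {suc k} v)
      in  twoLevel⇒¬oddValAt k g M′ two′
            (oddValAt-p²*⁻¹ prime k ∣ M′ ∣ (subst (OddValAt p (2 ℕ.+ k)) ∣M∣≡p²∣M′∣ v))

    twoLevel⇒¬oddVal : ∀ (f : Cyclic e) M → TwoLevel d (at f) M → ¬ OddValℕ p ∣ M ∣
    twoLevel⇒¬oddVal f M two (k , v) = twoLevel⇒¬oddValAt k f M two v

module Projection (d f′ n : ℕ) (n≡f*e : n ≡ suc f′ ℕ.* suc d) (A : ℕ → ℤ)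
  (A-periodic : Periodic n A) (A-±1 : ∀ j → A j ≡ + 1 ⊎ A j ≡ - + 1)
  (A-correlation : ∀ t → 1 ≤ t → t < n → correlation n A t ≡ + 3) where

  open import Data.Integer using (_+_; _*_; _-_; 1ℤ)

  e f : ℕ
  e = suc d
  f = suc f′

  -- The image of A under the projection ℤ/n → ℤ/e.
  fold : ℕ → ℤ
  fold j = sumTo f (λ u → A (j ℕ.+ u ℕ.* e))

  fiber-periodic : ∀ c → Periodic f (λ u → A (c ℕ.+ u ℕ.* e))
  fiber-periodic c u = trans (cong A (trans (shuffle c u f′ d) (cong (c ℕ.+ u ℕ.* e ℕ.+_) (sym n≡f*e))))
                             (A-periodic _)
    where
    shuffle : ∀ c u f′ d → c ℕ.+ (u ℕ.+ suc f′) ℕ.* suc d ≡ c ℕ.+ u ℕ.* suc d ℕ.+ suc f′ ℕ.* suc d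
    shuffle = ℕSolver.solve-∀

  fold-periodic : Periodic e fold
  fold-periodic j = trans (sumTo-ext f (λ u → cong A (shuffle j u d))) (sumTo-shift f _ (fiber-periodic j) 1)
    where
    shuffle : ∀ j u d → j ℕ.+ suc d ℕ.+ u ℕ.* suc d ≡ j ℕ.+ (u ℕ.+ 1) ℕ.* suc d
    shuffle = ℕSolver.solve-∀

  correlation-fold : ∀ s → correlation e fold s ≡ sumTo f (λ w → correlation n A (s ℕ.+ w ℕ.* e))
  correlation-fold s = begin
    sumTo e (λ j → fold j * fold (j ℕ.+ s))
      ≡⟨ sumTo-ext e product ⟩
    sumTo e (λ j → sumTo f (λ w → sumTo f (λ u → term w (j ℕ.+ u ℕ.* e))))
      ≡⟨ sumTo-swap e f (λ j w → sumTo f (λ u → term w (j ℕ.+ u ℕ.* e))) ⟩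
    sumTo f (λ w → sumTo e (λ j → sumTo f (λ u → term w (j ℕ.+ u ℕ.* e))))
      ≡⟨ sumTo-ext f (λ w → sumTo-swap e f (λ j u → term w (j ℕ.+ u ℕ.* e))) ⟩
    sumTo f (λ w → sumTo f (λ u → sumTo e (λ j → term w (j ℕ.+ u ℕ.* e))))
      ≡⟨ sumTo-ext f (λ w → trans (sym (sumTo-blocks f e (term w)))
                                  (cong (λ z → sumTo z (term w)) (sym n≡f*e))) ⟩
    sumTo f (λ w → correlation n A (s ℕ.+ w ℕ.* e)) ∎
    where
    open ≡-Reasoning
    term : ℕ → ℕ → ℤ
    term w i = A i * A (i ℕ.+ (s ℕ.+ w ℕ.* e))
    shuffle : ∀ j u s w d →
      j ℕ.+ s ℕ.+ (w ℕ.+ u) ℕ.* suc d ≡ j ℕ.+ u ℕ.* suc d ℕ.+ (s ℕ.+ w ℕ.* suc d)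
    shuffle = ℕSolver.solve-∀
    product : ∀ j → fold j * fold (j ℕ.+ s) ≡ sumTo f (λ w → sumTo f (λ u → term w (j ℕ.+ u ℕ.* e)))
    product j = begin
      fold j * fold (j ℕ.+ s)
        ≡⟨ sumTo-*ʳ f (fold (j ℕ.+ s)) (λ u → A (j ℕ.+ u ℕ.* e)) ⟨
      sumTo f (λ u → A (j ℕ.+ u ℕ.* e) * fold (j ℕ.+ s))
        ≡⟨ sumTo-ext f (λ u → cong (A (j ℕ.+ u ℕ.* e) *_) (sumTo-shift f _ (fiber-periodic (j ℕ.+ s)) u)) ⟨
      sumTo f (λ u → A (j ℕ.+ u ℕ.* e) * sumTo f (λ w → A (j ℕ.+ s ℕ.+ (w ℕ.+ u) ℕ.* e)))
        ≡⟨ sumTo-ext f (λ u → sumTo-*ˡ f (A (j ℕ.+ u ℕ.* e)) _) ⟨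
      sumTo f (λ u → sumTo f (λ w → A (j ℕ.+ u ℕ.* e) * A (j ℕ.+ s ℕ.+ (w ℕ.+ u) ℕ.* e)))
        ≡⟨ sumTo-ext f (λ u → sumTo-ext f (λ w →
             cong (λ z → A (j ℕ.+ u ℕ.* e) * A z) (shuffle j u s w d))) ⟩
      sumTo f (λ u → sumTo f (λ w → term w (j ℕ.+ u ℕ.* e)))
        ≡⟨ sumTo-swap f f (λ u w → term w (j ℕ.+ u ℕ.* e)) ⟩
      sumTo f (λ w → sumTo f (λ u → term w (j ℕ.+ u ℕ.* e))) ∎

  A²≡1 : ∀ i → A i * A (i ℕ.+ 0) ≡ 1ℤ
  A²≡1 i rewrite ℕP.+-identityʳ i with A-±1 i
  ... | inj₁ Aᵢ≡1  rewrite Aᵢ≡1  = refl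
  ... | inj₂ Aᵢ≡-1 rewrite Aᵢ≡-1 = refl

  correlation-A-0 : correlation n A 0 ≡ + n
  correlation-A-0 = trans (sumTo-ext n A²≡1) (trans (sumTo-const n 1ℤ) (ℤP.*-identityʳ (+ n)))

  off-peak : ∀ s w → s < e → w < f′ → 1 ≤ s ℕ.+ suc w ℕ.* e × s ℕ.+ suc w ℕ.* e < n
  off-peak s w s<e w<f′ = ℕP.≤-trans (s≤s z≤n) (ℕP.m≤n+m (suc w ℕ.* e) s) ,
    ℕP.<-≤-trans (ℕP.+-monoˡ-< (suc w ℕ.* e) s<e)
      (ℕP.≤-trans (ℕP.*-monoˡ-≤ e (s≤s w<f′)) (ℕP.≤-reflexive (sym n≡f*e)))

  off-peak-sum : ∀ s → s < e → sumTo f′ (λ w → correlation n A (s ℕ.+ suc w ℕ.* e)) ≡ + f′ * + 3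
  off-peak-sum s s<e = trans
    (sumTo-cong f′ (λ w w<f′ → let 1≤t , t<n = off-peak s w s<e w<f′ in A-correlation _ 1≤t t<n))
    (sumTo-const f′ (+ 3))

  correlation-fold-0 : correlation e fold 0 ≡ + n + + f′ * + 3
  correlation-fold-0 = trans (correlation-fold 0)
    (trans (sumTo-suc f′ _) (cong₂ _+_ correlation-A-0 (off-peak-sum 0 (s≤s z≤n))))

  correlation-fold-suc : ∀ s → suc s < e → correlation e fold (suc s) ≡ + 3 + + f′ * + 3
  correlation-fold-suc s 1+s<e = trans (correlation-fold (suc s)) (trans (sumTo-suc f′ _)
    (cong₂ _+_ (trans (cong (correlation n A) (ℕP.+-identityʳ (suc s)))
                      (A-correlation (suc s) (s≤s z≤n) (ℕP.<-≤-trans 1+s<e e≤n)))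
               (off-peak-sum (suc s) 1+s<e)))
    where
    e≤n : e ≤ n
    e≤n = ℕP.≤-trans (ℕP.m≤m+n e (f′ ℕ.* e)) (ℕP.≤-reflexive (sym n≡f*e))

  K : ℤ
  K = sumTo e fold

  K² : K * K ≡ (+ n + + f′ * + 3) + + d * (+ 3 + + f′ * + 3)
  K² = begin
    K * K                                                ≡⟨ sumTo-correlation e fold fold-periodic ⟨
    sumTo e (correlation e fold)                         ≡⟨ sumTo-suc d (correlation e fold) ⟩
    correlation e fold 0 + sumTo d (λ s → correlation e fold (suc s))
      ≡⟨ cong₂ _+_ correlation-fold-0
           (trans (sumTo-cong d (λ s s<d → correlation-fold-suc s (s≤s s<d))) (sumTo-const d _)) ⟩
    (+ n + + f′ * + 3) + + d * (+ 3 + + f′ * + 3)        ∎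
    where open ≡-Reasoning

  Y : Cyclic e
  Y = cyclic (λ j → + e * fold j - K) (λ j → cong (λ z → + e * z - K) (fold-periodic j))

  -- Once e and n are written as 1 + d and (1 + f′)(1 + d), both values are polynomial identities.
  Y-twoLevel : TwoLevel d (at Y) (+ e * (+ n - + 3))
  Y-twoLevel = peak , off
    where
    e≡1+d : + e ≡ 1ℤ + + d
    e≡1+d = ℤP.pos-+ 1 d
    n≡[1+f′][1+d] : + n ≡ (1ℤ + + f′) * (1ℤ + + d)
    n≡[1+f′][1+d] =
      trans (cong +_ n≡f*e) (trans (ℤP.pos-* (suc f′) (suc d)) (cong₂ _*_ (ℤP.pos-+ 1 f′) e≡1+d))
    scaled-K² : ℤ → ℤ → ℤ → ℤ → ℤ
    scaled-K² E N F D = E * ((N + F * + 3) + D * (+ 3 + F * + 3))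
    identity₀ : ∀ E N F D → E ≡ 1ℤ + D → N ≡ (1ℤ + F) * (1ℤ + D) →
      (E * E) * (N + F * + 3) - scaled-K² E N F D ≡ (E * (N - + 3)) * D
    identity₀ _ _ F D refl refl = solved F D
      where
      solved : ∀ F D → ((1ℤ + D) * (1ℤ + D)) * ((1ℤ + F) * (1ℤ + D) + F * + 3)
                         - (1ℤ + D) * (((1ℤ + F) * (1ℤ + D) + F * + 3) + D * (+ 3 + F * + 3))
                     ≡ ((1ℤ + D) * ((1ℤ + F) * (1ℤ + D) - + 3)) * D
      solved = solve-∀
    identity₁ : ∀ E N F D → E ≡ 1ℤ + D → N ≡ (1ℤ + F) * (1ℤ + D) →
      (E * E) * (+ 3 + F * + 3) - scaled-K² E N F D ≡ - (E * (N - + 3))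
    identity₁ _ _ F D refl refl = solved F D
      where
      solved : ∀ F D → ((1ℤ + D) * (1ℤ + D)) * (+ 3 + F * + 3)
                         - (1ℤ + D) * (((1ℤ + F) * (1ℤ + D) + F * + 3) + D * (+ 3 + F * + 3))
                     ≡ - ((1ℤ + D) * ((1ℤ + F) * (1ℤ + D) - + 3))
      solved = solve-∀
    peak : correlation e (at Y) 0 ≡ + e * (+ n - + 3) * + d
    peak = trans (correlation-centered e fold fold-periodic 0)
      (trans (cong₂ (λ u v → (+ e * + e) * u - + e * v) correlation-fold-0 K²)
             (identity₀ (+ e) (+ n) (+ f′) (+ d) e≡1+d n≡[1+f′][1+d]))
    off : ∀ s → 1 ≤ s → s < e → correlation e (at Y) s ≡ - (+ e * (+ n - + 3))
    off (suc s) _ 1+s<e = trans (correlation-centered e fold fold-periodic (suc s))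
      (trans (cong₂ (λ u v → (+ e * + e) * u - + e * v) (correlation-fold-suc s 1+s<e) K²)
             (identity₁ (+ e) (+ n) (+ f′) (+ d) e≡1+d n≡[1+f′][1+d]))

module Arithmetic where

  open import Data.Integer using (-[1+_])

  ∤-smaller : ∀ {p m} → 0 < m → m < p → ¬ p ∣ m
  ∤-smaller {p} {m} 0<m m<p p∣m = ℕP.<⇒≱ m<p (ℕDiv.∣⇒≤ {{ℕ.>-nonZero 0<m}} p∣m)

  pos-^ : ∀ a c → (+ a) ℤ.^ c ≡ + (a ℕ.^ c)
  pos-^ a zero    = refl
  pos-^ a (suc c) = trans (cong (+ a ℤ.*_) (pos-^ a c)) (sym (ℤP.pos-* a (a ℕ.^ c)))

  ∣a^c+[1+k]∣ : ∀ a c k → ℤ.∣ (+ a) ℤ.^ c ℤ.- - (+ suc k) ∣ ≡ a ℕ.^ c ℕ.+ suc k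
  ∣a^c+[1+k]∣ a c k = cong (λ z → ℤ.∣ z ℤ.+ + suc k ∣) (pos-^ a c)

  prime-1-mod-6⇒7≤ : ∀ {e} → Prime e → e % 6 ≡ 1 → 7 ≤ e
  prime-1-mod-6⇒7≤ {1} 1-prime _ = ⊥-elim (ℕ.nonTrivial⇒≢1 {{prime⇒nonTrivial 1-prime}} refl)
  prime-1-mod-6⇒7≤ {suc (suc (suc (suc (suc (suc (suc k))))))} _ _ = ℕP.m≤m+n 7 k

  x^2≡x*x : ∀ x → x ℕ.^ 2 ≡ x ℕ.* x
  x^2≡x*x x = cong (x ℕ.*_) (ℕP.*-identityʳ x)

  -- b = (A² - 9)/4 is n - 3.
  ±3-mod-8-decomposition : ∀ A → (A % 8 ≡ 3 ⊎ A % 8 ≡ 5) →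
    Σ ℕ λ a → Σ ℕ λ b →
      A ≡ 3 ℕ.+ a × A ℕ.^ 2 ℕ.+ 3 ≡ (3 ℕ.+ b) ℕ.* 4 × a ℕ.* (a ℕ.+ 6) ≡ 4 ℕ.* b
  ±3-mod-8-decomposition A (inj₁ A≡3) =
    q ℕ.* 8 , q ℕ.* q ℕ.* 16 ℕ.+ q ℕ.* 12 , A≡ ,
    trans (cong (ℕ._+ 3) (x^2≡x*x A)) (trans (cong (λ x → x ℕ.* x ℕ.+ 3) A≡) (square q)) , product q
    where
    q : ℕ
    q = A / 8
    A≡ : A ≡ 3 ℕ.+ q ℕ.* 8
    A≡ = trans (ℕD.m≡m%n+[m/n]*n A 8) (cong (ℕ._+ q ℕ.* 8) A≡3)
    square : ∀ q →
      (3 ℕ.+ q ℕ.* 8) ℕ.* (3 ℕ.+ q ℕ.* 8) ℕ.+ 3 ≡ (3 ℕ.+ (q ℕ.* q ℕ.* 16 ℕ.+ q ℕ.* 12)) ℕ.* 4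
    square = ℕSolver.solve-∀
    product : ∀ q → q ℕ.* 8 ℕ.* (q ℕ.* 8 ℕ.+ 6) ≡ 4 ℕ.* (q ℕ.* q ℕ.* 16 ℕ.+ q ℕ.* 12)
    product = ℕSolver.solve-∀
  ±3-mod-8-decomposition A (inj₂ A≡5) =
    2 ℕ.+ q ℕ.* 8 , 4 ℕ.+ q ℕ.* 20 ℕ.+ q ℕ.* q ℕ.* 16 , A≡ ,
    trans (cong (ℕ._+ 3) (x^2≡x*x A)) (trans (cong (λ x → x ℕ.* x ℕ.+ 3) A≡) (square q)) , product q
    where
    q : ℕ
    q = A / 8
    A≡ : A ≡ 3 ℕ.+ (2 ℕ.+ q ℕ.* 8)
    A≡ = trans (ℕD.m≡m%n+[m/n]*n A 8) (cong (ℕ._+ q ℕ.* 8) A≡5)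
    square : ∀ q → (3 ℕ.+ (2 ℕ.+ q ℕ.* 8)) ℕ.* (3 ℕ.+ (2 ℕ.+ q ℕ.* 8)) ℕ.+ 3
                   ≡ (3 ℕ.+ (4 ℕ.+ q ℕ.* 20 ℕ.+ q ℕ.* q ℕ.* 16)) ℕ.* 4
    square = ℕSolver.solve-∀
    product : ∀ q →
      (2 ℕ.+ q ℕ.* 8) ℕ.* (2 ℕ.+ q ℕ.* 8 ℕ.+ 6) ≡ 4 ℕ.* (4 ℕ.+ q ℕ.* 20 ℕ.+ q ℕ.* q ℕ.* 16)
    product = ℕSolver.solve-∀

  ValuationCondition : ℕ → ℕ → Set
  ValuationCondition p A =
    (p ≡ 2 × OddVal 2 ((+ A) ℤ.^ 2 ℤ.- + 9))
      ⊎ (p ≡ 3 × ∃ λ (A′ : ℤ) → (+ A ≡ + 3 ℤ.* A′) × (OddVal 3 (A′ ℤ.- + 1) ⊎ OddVal 3 (A′ ℤ.+ + 1)))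
      ⊎ (5 ≤ p × (OddVal p (+ A ℤ.+ + 3) ⊎ OddVal p (+ A ℤ.- + 3)))

  -- OddVal p m unfolds to OddValℕ p ∣ m ∣, and here b = (A² - 9)/4 = a(a + 6)/4.
  valuationCondition⇒oddVal : ∀ {p A a b} → Prime p → A ≡ 3 ℕ.+ a → a ℕ.* (a ℕ.+ 6) ≡ 4 ℕ.* b →
    ValuationCondition p A → OddValℕ p b
  valuationCondition⇒oddVal {A = A} {a} {b} p-prime A≡ a[a+6]≡4b (inj₁ (refl , v)) =
    oddVal-p²*⁻¹ p-prime b (subst (OddValℕ 2) ∣A²-9∣≡4b v)
    where
    expand : ∀ a → (3 ℕ.+ a) ℕ.* (3 ℕ.+ a) ≡ 9 ℕ.+ a ℕ.* (a ℕ.+ 6)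
    expand = ℕSolver.solve-∀
    A²≡9+a[a+6] : A ℕ.^ 2 ≡ 9 ℕ.+ a ℕ.* (a ℕ.+ 6)
    A²≡9+a[a+6] = trans (x^2≡x*x A) (trans (cong (λ x → x ℕ.* x) A≡) (expand a))
    ∣A²-9∣≡4b : ℤ.∣ (+ A) ℤ.^ 2 ℤ.- + 9 ∣ ≡ 4 ℕ.* b
    ∣A²-9∣≡4b =
      trans (cong (λ z → ℤ.∣ z ℤ.- + 9 ∣) (trans (pos-^ A 2) (cong +_ A²≡9+a[a+6]))) a[a+6]≡4b
  valuationCondition⇒oddVal p-prime A≡ a[a+6]≡4b (inj₂ (inj₁ (refl , -[1+ _ ] , () , _)))
  valuationCondition⇒oddVal p-prime () a[a+6]≡4b (inj₂ (inj₁ (refl , + zero , refl , _)))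
  valuationCondition⇒oddVal {a = a} {b} p-prime A≡ a[a+6]≡4b (inj₂ (inj₁ (refl , + suc a′ , refl , v))) =
    oddVal-*ˡ⁻¹ p-prime 4 b (from-no (3 ℕDiv.∣? 4))
      (subst (OddValℕ 3) (trans 9a′[a′+2]≡a[a+6] a[a+6]≡4b)
        (oddVal-p²* p-prime _ (oddVal-*-coprime p-prime a′ (suc a′ ℕ.+ 1) coprime v)))
    where
    coprime : 3 ∣ a′ → 3 ∣ suc a′ ℕ.+ 1 → ⊥
    coprime 3∣a′ 3∣a′+2 = from-no (3 ℕDiv.∣? 2)
      (ℕDiv.∣m+n∣m⇒∣n (subst (3 ∣_) (sym (ℕP.+-suc a′ 1)) 3∣a′+2) 3∣a′)
    triple : ∀ a′ → 3 ℕ.* suc a′ ≡ 3 ℕ.+ 3 ℕ.* a′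
    triple = ℕSolver.solve-∀
    a≡3a′ : a ≡ 3 ℕ.* a′
    a≡3a′ = ℕP.+-cancelˡ-≡ 3 a (3 ℕ.* a′) (trans (sym A≡) (triple a′))
    expand : ∀ a′ → (3 ℕ.* 3) ℕ.* (a′ ℕ.* (suc a′ ℕ.+ 1)) ≡ (3 ℕ.* a′) ℕ.* (3 ℕ.* a′ ℕ.+ 6)
    expand = ℕSolver.solve-∀
    9a′[a′+2]≡a[a+6] : (3 ℕ.* 3) ℕ.* (a′ ℕ.* (suc a′ ℕ.+ 1)) ≡ a ℕ.* (a ℕ.+ 6)
    9a′[a′+2]≡a[a+6] = trans (expand a′) (cong (λ z → z ℕ.* (z ℕ.+ 6)) (sym a≡3a′))
  valuationCondition⇒oddVal {p} {a = a} {b} p-prime refl a[a+6]≡4b (inj₂ (inj₂ (5≤p , v))) =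
    oddVal-*ˡ⁻¹ p-prime 4 b (∤-smaller (s≤s z≤n) (ℕP.<-≤-trans (ℕP.n<1+n 4) 5≤p))
      (subst (OddValℕ p) a[a+6]≡4b (oddVal-*-coprime p-prime a (a ℕ.+ 6) coprime v′))
    where
    shift : ∀ a → 3 ℕ.+ a ℕ.+ 3 ≡ a ℕ.+ 6
    shift = ℕSolver.solve-∀
    v′ : OddValℕ p a ⊎ OddValℕ p (a ℕ.+ 6)
    v′ = Sum.swap (Sum.map₁ (subst (OddValℕ p) (shift a)) v)
    coprime : p ∣ a → p ∣ a ℕ.+ 6 → ⊥
    coprime p∣a p∣a+6 with euclidsLemma 2 3 p-prime (ℕDiv.∣m+n∣m⇒∣n p∣a+6 p∣a)
    ... | inj₁ p∣2 = ∤-smaller (s≤s z≤n) (ℕP.≤-trans (ℕP.m≤m+n 3 2) 5≤p) p∣2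
    ... | inj₂ p∣3 = ∤-smaller (s≤s z≤n) (ℕP.≤-trans (ℕP.m≤m+n 4 1) 5≤p) p∣3

  semiprimitive⇒exponent : ∀ {e p} → 7 ≤ e → Semiprimitive (+ p) e → Σ ℕ λ c → e ∣ p ℕ.^ suc c ℕ.+ 1
  semiprimitive⇒exponent {e} {p} 7≤e (zero , e∣2) =
    ⊥-elim (∤-smaller (s≤s z≤n) (ℕP.≤-trans (ℕP.m≤m+n 3 4) 7≤e) (subst (e ∣_) (∣a^c+[1+k]∣ p 0 0) e∣2))
  semiprimitive⇒exponent {e} {p} _ (suc c , e∣p^c+1) = c , subst (e ∣_) (∣a^c+[1+k]∣ p (suc c) 0) e∣p^c+1

  p∤e : ∀ {e p c} → Prime e → Prime p → e ∣ p ℕ.^ suc c ℕ.+ 1 → ¬ p ∣ e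
  p∤e {e} {p} {c} e-prime p-prime e∣p^[1+c]+1 p∣e with prime⇒irreducible e-prime p∣e
  ... | inj₁ refl = ℕ.nonTrivial⇒≢1 {{prime⇒nonTrivial p-prime}} refl
  ... | inj₂ refl = ℕ.nonTrivial⇒≢1 {{prime⇒nonTrivial e-prime}}
                      (ℕDiv.∣1⇒≡1 (ℕDiv.∣m+n∣m⇒∣n e∣p^[1+c]+1 (ℕDiv.m∣m*n (p ℕ.^ c))))

  e∣m*4⇒e∣m : ∀ {e m} → Prime e → 7 ≤ e → e ∣ suc m ℕ.* 4 → Σ ℕ λ f′ → suc m ≡ suc f′ ℕ.* e
  e∣m*4⇒e∣m {e} {m} e-prime 7≤e e∣4m with euclidsLemma (suc m) 4 e-prime e∣4m
  ... | inj₂ e∣4 = ⊥-elim (∤-smaller (s≤s z≤n) (ℕP.≤-trans (ℕP.m≤m+n 5 2) 7≤e) e∣4)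
  ... | inj₁ (ℕDiv.divides (suc f′) m≡f*e) = f′ , m≡f*e

open Arithmetic

theorem4p4 : (e p A : ℕ) → Prime e → Prime p → e % 6 ≡ 1 → Semiprimitive (+ p) e →
  0 < A → (A % 8 ≡ 3 ⊎ A % 8 ≡ 5) →
  CongMod ((+ A) ℤ.^ 2) (- (+ 3)) e →
  ((p ≡ 2 × OddVal 2 ((+ A) ℤ.^ 2 ℤ.- + 9))
    ⊎ (p ≡ 3 × ∃ λ (A′ : ℤ) → (+ A ≡ + 3 ℤ.* A′) × (OddVal 3 (A′ ℤ.- + 1) ⊎ OddVal 3 (A′ ℤ.+ + 1)))
    ⊎ (5 ≤ p × (OddVal p (+ A ℤ.+ + 3) ⊎ OddVal p (+ A ℤ.- + 3)))) →
  ¬ (Σ (BinarySeq ((A ℕ.^ 2 ℕ.+ 3) / 4)) λ a →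
       ∀ t → 1 ≤ t → t < (A ℕ.^ 2 ℕ.+ 3) / 4 → autocorr a t ≡ + 3)
theorem4p4 (suc d) p A e-prime p-prime e%6≡1 semiprimitive _ A≡±3 e∣A²+3 condition (s , s-corr) =
  let e                     = suc d
      7≤e                   = prime-1-mod-6⇒7≤ e-prime e%6≡1
      c , e∣p^[1+c]+1       = semiprimitive⇒exponent 7≤e semiprimitive
      a , b , A≡3+a , A²+3≡[3+b]*4 , a[a+6]≡4b = ±3-mod-8-decomposition A A≡±3
      n                     = (A ℕ.^ 2 ℕ.+ 3) / 4
      n≡3+b                 = trans (cong (_/ 4) A²+3≡[3+b]*4) (ℕD.m*n/n≡m (3 ℕ.+ b) 4)
      e∣[3+b]*4             = subst (e ∣_) (trans (∣a^c+[1+k]∣ A 2 2) A²+3≡[3+b]*4) e∣A²+3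
      f′ , 3+b≡[1+f′]*e     = e∣m*4⇒e∣m e-prime 7≤e e∣[3+b]*4
      open Projection d f′ n (trans n≡3+b 3+b≡[1+f′]*e) (BinarySeq.seq s) (BinarySeq.periodic s)
                      (BinarySeq.pm1 s) s-corr using (Y; Y-twoLevel)
      ∣M∣≡e*b               = trans (ℤP.abs-* (+ e) (+ n ℤ.- + 3))
                                    (cong (λ m → e ℕ.* ℤ.∣ + m ℤ.- + 3 ∣) n≡3+b)
      v-b                   = valuationCondition⇒oddVal p-prime A≡3+a a[a+6]≡4b condition
      v-e*b                 = oddVal-*ˡ p-prime e b (p∤e {c = c} e-prime p-prime e∣p^[1+c]+1) v-b
      1≤d                   = ℕP.≤-pred (ℕP.≤-trans (ℕP.m≤m+n 2 5) 7≤e)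
      p^[1+c]≡ₑd            = GroupRing.e∣1+x⇒x≡ₑd d p (p ℕ.^ suc c) e∣p^[1+c]+1
  in  Descent.twoLevel⇒¬oddVal d p p-prime 1≤d c p^[1+c]≡ₑd Y (+ e ℤ.* (+ n ℤ.- + 3)) Y-twoLevel
        (subst (OddValℕ p) (sym ∣M∣≡e*b) v-e*b)
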